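{- Let $q\ge1$ be real, ${\sf m}=(m_1,\dots,m_\ell)$ a composition of $n$, and ${\sf x}=(x_1,\dots,x_n)$ positive reals with sum $1$ which are ${\sf m}$-compatible; put $\overline{x}_j=[m_j]_q\,x_{n_j}$. Let $\mathrm{proj}_{W_{\sf m}}:\mathbb{R}[\mathfrak{S}_n]\to\mathbb{R}[W_{\sf m}]$ and $\mathrm{incl}_{\mathfrak{S}_n}:\mathbb{R}[W_{\sf m}]\to\mathbb{R}[\mathfrak{S}_n]$ be the linear maps in the context. Then for all $\pi\in\mathfrak{S}_n$ and $w\in W_{\sf m}$, \[ \mathrm{proj}_{W_{\sf m}}(\pi\cdot\mathcal{T}_{\mathfrak{S}_n}(q,{\sf x}))=\mathrm{proj}_{W_{\sf m}}(\pi)\cdot\mathcal{T}_{W_{\sf m}}(q,\overline{{\sf x}}),\qquad \mathrm{incl}_{\mathfrak{S}_n}(w\cdot\mathcal{T}_{W_{\sf m}}(q,\overline{{\sf x}}))=\mathrm{incl}_{\mathfrak{S}_n}(w)\cdot\mathcal{T}_{\mathfrak{S}_n}(q,{\sf x}). \]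
   Context: $[m]_q=1+q+\cdots+q^{m-1}$; $n_j=m_1+\cdots+m_j$ ($n_0=0$), $M_j=\{n_{j-1}+1,\dots,n_j\}$. ${\sf x}$ is ${\sf m}$-compatible if $y_i=x_i/q^{n-i}$ is constant on each $M_j$. $W_{\sf m}$ is the set of words of length $n$ in $\{1,\dots,\ell\}$ with $m_j$ copies of $j$. Permutations (one-line notation): $\pi\cdot T_i=q\,\pi s_i$ if $\pi_{i+1}<\pi_i$, $\pi\cdot T_i=\pi s_i+(q-1)\pi$ if $\pi_{i+1}>\pi_i$ ($\pi s_i$ swaps positions $i,i+1$); $\pi\cdot\mathcal{X}=\frac{x_{\pi_1}}{q^{n-\pi_1}}\pi$; $\mathcal{T}_{\mathfrak{S}_n}(q,{\sf x})=\sum_{i=1}^nT_{i-1}\cdots T_1\mathcal{X}$ acting on the right (apply $T_{i-1}$ first, …, $T_1$, then $\mathcal{X}$; $i=1$ term is $\mathcal{X}$). Words: $w\cdot T_i=q\,ws_i$ if $w_{i+1}\le w_i$, $w\cdot T_i=ws_i+(q-1)w$ if $w_{i+1}>w_i$; $w\cdot\mathcal{X}=\frac{\overline{x}_{w_1}}{q^{m_{w_1+1}+\cdots+m_\ell}[m_{w_1}]_q}w$; $\mathcal{T}_{W_{\sf m}}(q,\overline{{\sf x}})=\sum_{i=1}^nT_{i-1}\cdots T_1\mathcal{X}$ similarly. Maps: ${\sf destd}_{\sf m}(\pi)$ replaces each letter of $\pi$ lying in $M_j$ by $j$; ${\sf std}(w)$ replaces, from left to right, the occurrences of letter $j$ in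 $w$ by $n_{j-1}+1,n_{j-1}+2,\dots,n_j$. $\mathfrak{S}_{\sf m}=\mathfrak{S}_{M_1}\times\cdots\times\mathfrak{S}_{M_\ell}$ (permutations of $[n]$ preserving each $M_j$), and for $\tau\in\mathfrak{S}_{\sf m}$, $\mathrm{inv}_{\sf m}(\tau)=\sum_j\mathrm{inv}(\tau|_{M_j})$. Then $\mathrm{proj}_{W_{\sf m}}(\pi)={\sf destd}_{\sf m}(\pi)$ and $\mathrm{incl}_{\mathfrak{S}_n}(w)=\sum_{\tau\in\mathfrak{S}_{\sf m}}q^{ -\mathrm{inv}_{\sf m}(\tau)}\,\tau\circ{\sf std}(w)$, where $\tau\circ{\sf std}(w)$ is the permutation obtained by applying $\tau$ to each letter (value) of ${\sf std}(w)$. -}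

module Defs where

open import Level using (Level; _⊔_) renaming (suc to lsuc)
open import Data.Bool using (Bool; true; false; if_then_else_; _∧_)
open import Data.Nat as ℕ using (ℕ; zero; suc; _∸_; _≡ᵇ_; _<ᵇ_; _≤ᵇ_)
open import Data.List using (List; []; _∷_; map; concat; concatMap; applyUpTo; upTo; take; drop; filterᵇ; all; foldr)
open import Data.Nat.ListAction using (sum)
open import Data.List.Properties using (≡-dec)
open import Data.Product using (_×_; _,_)
open import Relation.Nullary using (¬_; does)
open import Relation.Binary using (Rel; IsTotalOrder)
open import Algebra.Core using (Op₁; Op₂)
open import Algebra.Structures using (IsCommutativeRing)

-- Ordered fields (the paper works over ℝ; stdlib has no reals, so the
-- statement is made for an arbitrary ordered field, ℝ being one).

record OrderedField (c ℓ₁ ℓ₂ : Level) : Set (lsuc (c ⊔ ℓ₁ ⊔ ℓ₂)) where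
  infixl 7 _*_
  infixl 6 _+_
  infix 4 _≈_ _≤_
  field
    Carrier : Set c
    _≈_ : Rel Carrier ℓ₁
    _+_ : Op₂ Carrier
    _*_ : Op₂ Carrier
    -_  : Op₁ Carrier
    0#  : Carrier
    1#  : Carrier
    isCommutativeRing : IsCommutativeRing _≈_ _+_ _*_ -_ 0# 1#
    _⁻¹ : Op₁ Carrier
    ⁻¹-inverse : ∀ x → ¬ (x ≈ 0#) → x * (x ⁻¹) ≈ 1#
    0≉1 : ¬ (0# ≈ 1#)
    _≤_ : Rel Carrier ℓ₂
    isTotalOrder : IsTotalOrder _≈_ _≤_
    +-mono-≤ : ∀ {x y} z → x ≤ y → x + z ≤ y + z
    *-nonneg : ∀ {x y} → 0# ≤ x → 0# ≤ y → 0# ≤ x * y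

  open IsCommutativeRing isCommutativeRing public

  infix 4 _<_
  _<_ : Rel Carrier (ℓ₁ ⊔ ℓ₂)
  x < y = (x ≤ y) × ¬ (x ≈ y)


-- Combinatorics on lists of naturals (1-indexed, as in the paper).
-- A composition m = (m_1,…,m_ℓ) is a List ℕ; n = sum m.
-- Permutations (one-line notation) and words are List ℕ.

-- entry at (1-indexed) position i, default 0
at : List ℕ → ℕ → ℕ
at (a ∷ as) (suc zero)    = a
at (a ∷ as) (suc (suc i)) = at as (suc i)
at _        _             = 0

-- π s_i : swap positions i and i+1 (1-indexed)
swapAt : ℕ → List ℕ → List ℕ
swapAt (suc zero)    (a ∷ b ∷ r) = b ∷ a ∷ r
swapAt (suc (suc i)) (a ∷ r)     = a ∷ swapAt (suc i) r
swapAt _             r           = r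

oneTo : ℕ → List ℕ
oneTo = applyUpTo suc

nPart : List ℕ → ℕ → ℕ
nPart m j = sum (take j m)

-- index j of the block M_j containing a (for 1 ≤ a ≤ n)
blk : List ℕ → ℕ → ℕ
blk []        a = 0
blk (mj ∷ ms) a = if a ≤ᵇ mj then 1 else suc (blk ms (a ∸ mj))

destd : List ℕ → List ℕ → List ℕ
destd m π = map (blk m) π

stdAux : List ℕ → List ℕ → (ℕ → ℕ) → List ℕ
stdAux m []      c = []
stdAux m (j ∷ w) c =
  (nPart m (j ∸ 1) ℕ.+ suc (c j)) ∷ stdAux m w (λ k → if k ≡ᵇ j then suc (c k) else c k)

std : List ℕ → List ℕ → List ℕ
std m w = stdAux m w (λ _ → 0)

-- the word 1^{m_1} 2^{m_2} ⋯ ℓ^{m_ℓ}; W_m = its rearrangements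
baseWordAux : ℕ → List ℕ → List ℕ
baseWordAux j []        = []
baseWordAux j (mj ∷ ms) = applyUpTo (λ _ → j) mj Data.List.++ baseWordAux (suc j) ms

baseWord : List ℕ → List ℕ
baseWord = baseWordAux 1

insertAll : ℕ → List ℕ → List (List ℕ)
insertAll a []      = (a ∷ []) ∷ []
insertAll a (b ∷ r) = (a ∷ b ∷ r) ∷ map (b ∷_) (insertAll a r)

perms : List ℕ → List (List ℕ)
perms []      = [] ∷ []
perms (a ∷ r) = concatMap (insertAll a) (perms r)

Sm : List ℕ → List (List ℕ)
Sm m = filterᵇ (λ τ → all (λ a → blk m (at τ a) ≡ᵇ blk m a) (oneTo (sum m)))
               (perms (oneTo (sum m)))

invm : List ℕ → List ℕ → ℕ
invm m τ = sum (map (λ a → sum (map (λ b → if (blk m a ≡ᵇ blk m b) ∧ (at τ b <ᵇ at τ a) then 1 else 0)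
                                     (applyUpTo (λ k → a ℕ.+ suc k) (sum m ∸ a))))
                    (oneTo (sum m)))

module Ops {c ℓ₁ ℓ₂} (F : OrderedField c ℓ₁ ℓ₂) where
  open OrderedField F

  -- a formal linear combination Σ c_b b of basis elements b : List ℕ
  LC : Set c
  LC = List (Carrier × List ℕ)

  basis : List ℕ → LC
  basis b = (1# , b) ∷ []

  coeff : LC → List ℕ → Carrier
  coeff []             b = 0#
  coeff ((k , b') ∷ u) b = if does (≡-dec ℕ._≟_ b' b) then k + coeff u b else coeff u b

  -- equality in the free module ℝ[B]
  infix 4 _≋_
  _≋_ : LC → LC → Set ℓ₁
  u ≋ v = ∀ b → coeff u b ≈ coeff v b

  scale : Carrier → LC → LC
  scale k = map (λ { (k' , b) → (k * k' , b) })

  extend : (List ℕ → LC) → LC → LC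
  extend f = concatMap (λ { (k , b) → scale k (f b) })

  sumF : List Carrier → Carrier
  sumF = foldr _+_ 0#

  pow : Carrier → ℕ → Carrier
  pow q zero    = 1#
  pow q (suc k) = q * pow q k

  qint : Carrier → ℕ → Carrier
  qint q zero    = 0#
  qint q (suc k) = qint q k + pow q k

  -- T_{S_n}-type operator Σ_{i=1}^n T_{i-1} ⋯ T_1 X (right action)
  chain : (ℕ → List ℕ → LC) → ℕ → LC → LC
  chain T zero    u = u
  chain T (suc k) u = chain T k (extend (T (suc k)) u)

  tsetlin : ℕ → (ℕ → List ℕ → LC) → (List ℕ → LC) → LC → LC
  tsetlin n T X u = concat (map (λ k → extend X (chain T k u)) (upTo n))

  TS : Carrier → ℕ → List ℕ → LC
  TS q i π = if at π (suc i) <ᵇ at π i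
             then (q , swapAt i π) ∷ []
             else (1# , swapAt i π) ∷ (q - 1# , π) ∷ []

  TW : Carrier → ℕ → List ℕ → LC
  TW q i w = if at w (suc i) ≤ᵇ at w i
             then (q , swapAt i w) ∷ []
             else (1# , swapAt i w) ∷ (q - 1# , w) ∷ []

  XS : Carrier → List ℕ → (ℕ → Carrier) → List ℕ → LC
  XS q m x π = (x (at π 1) * (pow q (sum m ∸ at π 1)) ⁻¹ , π) ∷ []

  XW : Carrier → List ℕ → (ℕ → Carrier) → List ℕ → LC
  XW q m xb w = (xb (at w 1) * (pow q (sum (drop (at w 1) m)) * qint q (at m (at w 1))) ⁻¹ , w) ∷ []

  TSn : Carrier → List ℕ → (ℕ → Carrier) → LC → LC
  TSn q m x = tsetlin (sum m) (TS q) (XS q m x)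

  TWm : Carrier → List ℕ → (ℕ → Carrier) → LC → LC
  TWm q m xb = tsetlin (sum m) (TW q) (XW q m xb)

  xbar : Carrier → List ℕ → (ℕ → Carrier) → ℕ → Carrier
  xbar q m x j = qint q (at m j) * x (nPart m j)

  proj : List ℕ → LC → LC
  proj m = map (λ { (k , π) → (k , destd m π) })

  incl : Carrier → List ℕ → LC → LC
  incl q m = extend (λ w → map (λ τ → ((pow q (invm m τ)) ⁻¹ , map (at τ) (std m w))) (Sm m))

  Compatible : Carrier → List ℕ → (ℕ → Carrier) → Set (ℓ₁)
  Compatible q m x = ∀ j i i' → 1 ℕ.≤ j → j ℕ.≤ Data.List.length m →
    nPart m (j ∸ 1) ℕ.< i → i ℕ.≤ nPart m j →
    nPart m (j ∸ 1) ℕ.< i' → i' ℕ.≤ nPart m j →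
    x i * (pow q (sum m ∸ i)) ⁻¹ ≈ x i' * (pow q (sum m ∸ i')) ⁻¹

module Submission where

-- Both maps are linear extensions of maps on basis elements, and each 𝒯 is assembled from
-- the generators 𝒳, T₁, …, T_{n-1}, so it suffices that the maps intertwine the generators.
-- For proj this holds because destd_m is weakly increasing, while the eigenvalues of 𝒳 agree
-- by m-compatibility. For incl, write incl(w) = E · std(w) with E = Σ_{τ ∈ 𝔖_m} q^{-inv_m τ} τ.
-- If w_i ≠ w_{i+1}, then τ ∘ std(w) has a descent at i exactly when w does. If w_i = w_{i+1},
-- then std(w) carries consecutive values a, a + 1 of one block at i, i + 1, so T_i acting on
-- E · std(w) is T_a acting on E, and E T_a = q E since τ ↦ τ s_a pairs off 𝔖_m, changing
-- inv_m by one.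

open import Defs
open import Data.Nat as ℕ using (ℕ)
open import Data.List using (List; map)
open import Data.Nat.ListAction using (sum)
open import Data.List.Relation.Unary.All using (All)
open import Data.List.Relation.Binary.Permutation.Propositional using (_↭_)
open import Data.Product using (_×_; _,_)
open import Relation.Binary.PropositionalEquality using (_≢_)

module Positions where
  open import Data.Bool using (true; false; if_then_else_)
  open import Data.Nat using (ℕ; zero; suc; _≤_; _<_; z≤n; s≤s; _≡ᵇ_; _<ᵇ_; _≤ᵇ_)
  open import Data.Nat.Properties using (_≟_; _<?_; _≤?_; 1+n≢n; <⇒≱; ≤⇒≯; n≤1+n; ≤-trans)
  open import Data.Product using (_,_)
  open import Data.Empty using (⊥-elim)
  open import Function using (_∘_)
  open import Data.List using (List; []; _∷_; map; length)
  open import Data.List.Properties using (map-id-local; map-∘; map-cong)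
  open import Data.List.Membership.Propositional using (_∈_)
  open import Data.List.Relation.Unary.Any using (here; there)
  open import Data.List.Relation.Binary.Permutation.Propositional using (_↭_; prep; swap; ↭-refl)
  open import Data.List.Relation.Unary.All as All using (All; []; _∷_)
  open import Data.List.Relation.Unary.AllPairs using (_∷_)
  open import Data.List.Relation.Unary.Unique.Propositional using (Unique)
  open import Relation.Nullary using (yes; no)
  open import Relation.Nullary.Decidable using (dec-true; dec-false)
  open import Relation.Binary.PropositionalEquality

  ≡ᵇ-≡ : ∀ {m n} → m ≡ n → (m ≡ᵇ n) ≡ true
  ≡ᵇ-≡ = dec-true (_ ≟ _)

  ≡ᵇ-≢ : ∀ {m n} → m ≢ n → (m ≡ᵇ n) ≡ false
  ≡ᵇ-≢ = dec-false (_ ≟ _)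

  <ᵇ-< : ∀ {m n} → m < n → (m <ᵇ n) ≡ true
  <ᵇ-< = dec-true (_ <? _)

  <ᵇ-≥ : ∀ {m n} → n ≤ m → (m <ᵇ n) ≡ false
  <ᵇ-≥ n≤m = dec-false (_ <? _) (≤⇒≯ n≤m)

  ≤ᵇ-≤ : ∀ {m n} → m ≤ n → (m ≤ᵇ n) ≡ true
  ≤ᵇ-≤ = dec-true (_ ≤? _)

  ≤ᵇ-> : ∀ {m n} → n < m → (m ≤ᵇ n) ≡ false
  ≤ᵇ-> n<m = dec-false (_ ≤? _) (<⇒≱ n<m)

  at-map : ∀ (f : ℕ → ℕ) π {i} → 1 ≤ i → i ≤ length π → at (map f π) i ≡ f (at π i)
  at-map f (a ∷ π) {suc zero}    _ _       = refl
  at-map f (a ∷ π) {suc (suc i)} _ (s≤s p) = at-map f π (s≤s z≤n) p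

  at-All : ∀ {P : ℕ → Set} {π} → All P π → ∀ {i} → 1 ≤ i → i ≤ length π → P (at π i)
  at-All (p ∷ _)  {suc zero}    _ _       = p
  at-All (_ ∷ ps) {suc (suc i)} _ (s≤s q) = at-All ps (s≤s z≤n) q

  swapAt-map : ∀ (f : ℕ → ℕ) i π → swapAt i (map f π) ≡ map f (swapAt i π)
  swapAt-map f (suc zero)    (a ∷ b ∷ π) = refl
  swapAt-map f (suc (suc i)) (a ∷ π)     = cong (f a ∷_) (swapAt-map f (suc i) π)
  swapAt-map f zero          π           = refl
  swapAt-map f (suc zero)    []          = refl
  swapAt-map f (suc zero)    (a ∷ [])    = refl
  swapAt-map f (suc (suc i)) []          = refl

  swapAt-involutive : ∀ i π → swapAt i (swapAt i π) ≡ π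
  swapAt-involutive (suc zero)    (a ∷ b ∷ π) = refl
  swapAt-involutive (suc (suc i)) (a ∷ π)     = cong (a ∷_) (swapAt-involutive (suc i) π)
  swapAt-involutive zero          π           = refl
  swapAt-involutive (suc zero)    []          = refl
  swapAt-involutive (suc zero)    (a ∷ [])    = refl
  swapAt-involutive (suc (suc i)) []          = refl

  swapAt-≡-swap : ∀ i {π ρ} → swapAt i π ≡ ρ → π ≡ swapAt i ρ
  swapAt-≡-swap i {π} π'≡ρ = trans (sym (swapAt-involutive i π)) (cong (swapAt i) π'≡ρ)

  swapAt-↭ : ∀ i π → swapAt i π ↭ π
  swapAt-↭ (suc zero)    (a ∷ b ∷ π) = swap b a ↭-refl
  swapAt-↭ (suc (suc i)) (a ∷ π)     = prep a (swapAt-↭ (suc i) π)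
  swapAt-↭ zero          π           = ↭-refl
  swapAt-↭ (suc zero)    []          = ↭-refl
  swapAt-↭ (suc zero)    (a ∷ [])    = ↭-refl
  swapAt-↭ (suc (suc i)) []          = ↭-refl

  swapAt-fixed : ∀ i w → at w i ≡ at w (suc i) → swapAt i w ≡ w
  swapAt-fixed (suc zero)    (a ∷ b ∷ w) a≡b = cong₂ (λ u v → u ∷ v ∷ w) (sym a≡b) a≡b
  swapAt-fixed (suc (suc i)) (a ∷ w)     e   = cong (a ∷_) (swapAt-fixed (suc i) w e)
  swapAt-fixed zero          w           _   = refl
  swapAt-fixed (suc zero)    []          _   = refl
  swapAt-fixed (suc zero)    (a ∷ [])    _   = refl
  swapAt-fixed (suc (suc i)) []          _   = refl

  at-swapAt-left : ∀ {a} τ → 1 ≤ a → suc a ≤ length τ → at (swapAt a τ) a ≡ at τ (suc a)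
  at-swapAt-left {suc zero}    (p ∷ q ∷ τ) _ _       = refl
  at-swapAt-left {suc zero}    (p ∷ [])    _ (s≤s ())
  at-swapAt-left {suc (suc a)} (p ∷ τ)     _ (s≤s l) = at-swapAt-left τ (s≤s z≤n) l

  at-swapAt-right : ∀ {a} τ → 1 ≤ a → suc a ≤ length τ → at (swapAt a τ) (suc a) ≡ at τ a
  at-swapAt-right {suc zero}    (p ∷ q ∷ τ) _ _       = refl
  at-swapAt-right {suc zero}    (p ∷ [])    _ (s≤s ())
  at-swapAt-right {suc (suc a)} (p ∷ τ)     _ (s≤s l) = at-swapAt-right τ (s≤s z≤n) l

  at-swapAt-other : ∀ a τ {x} → x ≢ a → x ≢ suc a → at (swapAt a τ) x ≡ at τ x
  at-swapAt-other (suc zero)    (p ∷ q ∷ τ) {zero}                x≢1 x≢2 = refl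
  at-swapAt-other (suc zero)    (p ∷ q ∷ τ) {suc zero}            x≢1 x≢2 = ⊥-elim (x≢1 refl)
  at-swapAt-other (suc zero)    (p ∷ q ∷ τ) {suc (suc zero)}      x≢1 x≢2 = ⊥-elim (x≢2 refl)
  at-swapAt-other (suc zero)    (p ∷ q ∷ τ) {suc (suc (suc x))}   x≢1 x≢2 = refl
  at-swapAt-other (suc (suc a)) (p ∷ τ)     {zero}                x≢a x≢a+1 = refl
  at-swapAt-other (suc (suc a)) (p ∷ τ)     {suc zero}            x≢a x≢a+1 = refl
  at-swapAt-other (suc (suc a)) (p ∷ τ)     {suc (suc x)}         x≢a x≢a+1 =
    at-swapAt-other (suc a) τ (x≢a ∘ cong suc) (x≢a+1 ∘ cong suc)
  at-swapAt-other zero          τ           _ _ = refl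
  at-swapAt-other (suc zero)    []          _ _ = refl
  at-swapAt-other (suc zero)    (p ∷ [])    _ _ = refl
  at-swapAt-other (suc (suc a)) []          _ _ = refl

  swapVal : ℕ → ℕ → ℕ
  swapVal a x = if x ≡ᵇ a then suc a else if x ≡ᵇ suc a then a else x

  swapVal-left : ∀ a → swapVal a a ≡ suc a
  swapVal-left a rewrite ≡ᵇ-≡ {a} refl = refl

  swapVal-right : ∀ a → swapVal a (suc a) ≡ a
  swapVal-right a rewrite ≡ᵇ-≢ (1+n≢n {a}) | ≡ᵇ-≡ {suc a} refl = refl

  swapVal-other : ∀ a {x} → x ≢ a → x ≢ suc a → swapVal a x ≡ x
  swapVal-other a x≢a x≢a+1 rewrite ≡ᵇ-≢ x≢a | ≡ᵇ-≢ x≢a+1 = refl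

  data SwapValView (a : ℕ) : ℕ → Set where
    left  : SwapValView a a
    right : SwapValView a (suc a)
    other : ∀ {x} → x ≢ a → x ≢ suc a → SwapValView a x

  swapValView : ∀ a x → SwapValView a x
  swapValView a x with x ≟ a | x ≟ suc a
  ... | yes refl | _        = left
  ... | no _     | yes refl = right
  ... | no x≢a   | no x≢a+1 = other x≢a x≢a+1

  at-swapAt : ∀ a τ → 1 ≤ a → suc a ≤ length τ → ∀ x → at (swapAt a τ) x ≡ at τ (swapVal a x)
  at-swapAt a τ 1≤a len x with swapValView a x
  ... | left  = trans (at-swapAt-left τ 1≤a len) (cong (at τ) (sym (swapVal-left a)))
  ... | right = trans (at-swapAt-right τ 1≤a len) (cong (at τ) (sym (swapVal-right a)))
  ... | other x≢a x≢a+1 = trans (at-swapAt-other a τ x≢a x≢a+1) (cong (at τ) (sym (swapVal-other a x≢a x≢a+1)))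

  map-swapVal : ∀ {a} i σ → Unique σ → 1 ≤ i → suc i ≤ length σ →
                at σ i ≡ a → at σ (suc i) ≡ suc a → map (swapVal a) σ ≡ swapAt i σ
  map-swapVal {a} (suc zero) (x ∷ y ∷ σ) ((_ ∷ x∉σ) ∷ y∉σ ∷ _) _ _ refl refl =
    cong₂ _∷_ (swapVal-left a) (cong₂ _∷_ (swapVal-right a)
      (map-id-local (All.zipWith (λ (p , q) → swapVal-other a (p ∘ sym) (q ∘ sym)) (x∉σ , y∉σ))))
  map-swapVal {a} (suc (suc i)) (x ∷ σ) (x∉σ ∷ uσ) _ (s≤s l) σi≡a σi+1≡a+1 =
    cong₂ _∷_ (swapVal-other a x≢a x≢a+1) (map-swapVal (suc i) σ uσ (s≤s z≤n) l σi≡a σi+1≡a+1)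
    where
    x≢a : x ≢ a
    x≢a x≡a = at-All x∉σ (s≤s z≤n) (≤-trans (n≤1+n _) l) (trans x≡a (sym σi≡a))
    x≢a+1 : x ≢ suc a
    x≢a+1 x≡a+1 = at-All x∉σ (s≤s z≤n) l (trans x≡a+1 (sym σi+1≡a+1))

  Unique⇒at-≢ : ∀ {σ} → Unique σ → ∀ {i} → 1 ≤ i → suc i ≤ length σ → at σ i ≢ at σ (suc i)
  Unique⇒at-≢ ((x≢y ∷ _) ∷ _)  {suc zero}    _ (s≤s (s≤s _)) = x≢y
  Unique⇒at-≢ (_ ∷ uσ)         {suc (suc i)} _ (s≤s l)       = Unique⇒at-≢ uσ (s≤s z≤n) l

  at-∈ : ∀ τ {i} → 1 ≤ i → i ≤ length τ → at τ i ∈ τ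
  at-∈ (x ∷ τ) {suc zero}    _ _       = here refl
  at-∈ (x ∷ τ) {suc (suc i)} _ (s≤s l) = there (at-∈ τ (s≤s z≤n) l)

  compose : List ℕ → List ℕ → List ℕ
  compose τ σ = map (at τ) σ

  swapAt-compose : ∀ {a} i τ σ → Unique σ → 1 ≤ i → suc i ≤ length σ → at σ i ≡ a → at σ (suc i) ≡ suc a →
                   1 ≤ a → suc a ≤ length τ → swapAt i (compose τ σ) ≡ compose (swapAt a τ) σ
  swapAt-compose {a} i τ σ uσ 1≤i len σᵢ σᵢ₊₁ 1≤a lenτ = begin
    swapAt i (map (at τ) σ)             ≡⟨ swapAt-map (at τ) i σ ⟩
    map (at τ) (swapAt i σ)             ≡⟨ cong (map (at τ)) (map-swapVal i σ uσ 1≤i len σᵢ σᵢ₊₁) ⟨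
    map (at τ) (map (swapVal a) σ)      ≡⟨ map-∘ σ ⟨
    map (at τ ∘ swapVal a) σ            ≡⟨ map-cong (λ y → sym (at-swapAt a τ 1≤a lenτ y)) σ ⟩
    map (at (swapAt a τ)) σ             ∎
    where open ≡-Reasoning

module Blocks where
  open Positions
  open import Data.Nat using (ℕ; zero; suc; _+_; _∸_; _≤_; _<_; z≤n; s≤s)
  open import Data.Nat.Properties
  open import Data.List using (List; []; _∷_; length; take; drop; _++_)
  open import Data.List.Properties using (take++drop≡id)
  open import Data.Nat.ListAction using (sum)
  open import Data.Nat.ListAction.Properties using (sum-++)
  open import Data.Empty using (⊥-elim)
  open import Relation.Nullary using (yes; no)
  open import Relation.Binary.PropositionalEquality
  open import Function using (_∘_)

  slot : List ℕ → ℕ → ℕ → ℕ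
  slot m j t = nPart m (j ∸ 1) + suc t

  blk-head : ∀ {mj} ms {a} → a ≤ mj → blk (mj ∷ ms) a ≡ 1
  blk-head ms a≤mj rewrite ≤ᵇ-≤ a≤mj = refl

  blk-tail : ∀ {mj} ms {a} → mj < a → blk (mj ∷ ms) a ≡ suc (blk ms (a ∸ mj))
  blk-tail ms mj<a rewrite ≤ᵇ-> mj<a = refl

  blk-mono : ∀ m {a b} → a ≤ b → blk m a ≤ blk m b
  blk-mono []        _   = z≤n
  blk-mono (mj ∷ ms) {a} {b} a≤b with a ≤? mj | b ≤? mj
  ... | yes a≤mj | yes b≤mj rewrite blk-head ms a≤mj | blk-head ms b≤mj = ≤-refl
  ... | yes a≤mj | no  b≰mj rewrite blk-head ms a≤mj | blk-tail ms (≰⇒> b≰mj) = s≤s z≤n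
  ... | no  a≰mj | yes b≤mj = ⊥-elim (a≰mj (≤-trans a≤b b≤mj))
  ... | no  a≰mj | no  b≰mj rewrite blk-tail ms (≰⇒> a≰mj) | blk-tail ms (≰⇒> b≰mj) =
    s≤s (blk-mono ms (∸-monoˡ-≤ mj a≤b))

  nPart-suc : ∀ mj ms j → 1 ≤ j → nPart (mj ∷ ms) j ≡ mj + nPart ms (j ∸ 1)
  nPart-suc mj ms (suc j) _ = refl

  nPart-step : ∀ m j → 1 ≤ j → nPart m (j ∸ 1) + at m j ≡ nPart m j
  nPart-step []        (suc zero)    _ = refl
  nPart-step []        (suc (suc j)) _ = refl
  nPart-step (mj ∷ ms) (suc zero)    _ = sym (+-identityʳ mj)
  nPart-step (mj ∷ ms) (suc (suc j)) _ =
    trans (+-assoc mj (nPart ms j) (at ms (suc j))) (cong (mj +_) (nPart-step ms (suc j) (s≤s z≤n)))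

  nPart≤sum : ∀ m j → nPart m j ≤ sum m
  nPart≤sum []        zero    = z≤n
  nPart≤sum []        (suc j) = z≤n
  nPart≤sum (mj ∷ ms) zero    = z≤n
  nPart≤sum (mj ∷ ms) (suc j) = +-monoʳ-≤ mj (nPart≤sum ms j)

  sum-drop : ∀ m j → sum (drop j m) ≡ sum m ∸ nPart m j
  sum-drop m j = begin
    sum (drop j m)                           ≡⟨ m+n∸m≡n (nPart m j) _ ⟨
    nPart m j + sum (drop j m) ∸ nPart m j   ≡⟨ cong (_∸ nPart m j) (sum-++ (take j m) (drop j m)) ⟨
    sum (take j m ++ drop j m) ∸ nPart m j   ≡⟨ cong (λ l → sum l ∸ nPart m j) (take++drop≡id j m) ⟩
    sum m ∸ nPart m j                        ∎
    where open ≡-Reasoning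

  record InBlock (m : List ℕ) (a j : ℕ) : Set where
    field
      1≤j   : 1 ≤ j
      j≤ℓ   : j ≤ length m
      lower : nPart m (j ∸ 1) < a
      upper : a ≤ nPart m j

  blk-InBlock : ∀ m {a} → 1 ≤ a → a ≤ sum m → InBlock m a (blk m a)
  blk-InBlock []        1≤a a≤0 = ⊥-elim (<⇒≱ 1≤a a≤0)
  blk-InBlock (mj ∷ ms) {a} 1≤a a≤n with a ≤? mj
  ... | yes a≤mj rewrite blk-head ms a≤mj = record
    { 1≤j = s≤s z≤n ; j≤ℓ = s≤s z≤n ; lower = 1≤a ; upper = subst (a ≤_) (sym (+-identityʳ mj)) a≤mj }
  ... | no a≰mj rewrite blk-tail ms (≰⇒> a≰mj) = record
    { 1≤j   = s≤s z≤n
    ; j≤ℓ   = s≤s j≤ℓ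
    ; lower = subst₂ _<_ (sym (nPart-suc mj ms j 1≤j)) a≡ (+-monoʳ-< mj lower)
    ; upper = subst (_≤ mj + nPart ms j) a≡ (+-monoʳ-≤ mj upper)
    }
    where
    a≡ : mj + (a ∸ mj) ≡ a
    a≡ = m+[n∸m]≡n (<⇒≤ (≰⇒> a≰mj))
    j = blk ms (a ∸ mj)
    open InBlock (blk-InBlock ms (m<n⇒0<n∸m (≰⇒> a≰mj))
                   (subst (a ∸ mj ≤_) (m+n∸m≡n mj (sum ms)) (∸-monoˡ-≤ mj a≤n)))

  1≤slot : ∀ m j t → 1 ≤ slot m j t
  1≤slot m j t = ≤-trans (s≤s z≤n) (m≤n+m (suc t) _)

  blk-slot : ∀ m j t → 1 ≤ j → t < at m j → blk m (slot m j t) ≡ j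
  blk-slot (mj ∷ ms) (suc zero)    t _ t<mj = blk-head ms t<mj
  blk-slot (mj ∷ ms) (suc (suc j)) t _ t<mⱼ = begin
    blk (mj ∷ ms) (mj + nPart ms j + suc t)   ≡⟨ cong (blk (mj ∷ ms)) (+-assoc mj _ _) ⟩
    blk (mj ∷ ms) (mj + slot ms (suc j) t)    ≡⟨ blk-tail ms (m<m+n mj (1≤slot ms (suc j) t)) ⟩
    suc (blk ms (mj + slot ms (suc j) t ∸ mj)) ≡⟨ cong (suc ∘ blk ms) (m+n∸m≡n mj _) ⟩
    suc (blk ms (slot ms (suc j) t))          ≡⟨ cong suc (blk-slot ms (suc j) t (s≤s z≤n) t<mⱼ) ⟩
    suc (suc j)                                ∎
    where open ≡-Reasoning

  slot≤sum : ∀ m j t → 1 ≤ j → t < at m j → slot m j t ≤ sum m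
  slot≤sum m j t 1≤j t<mj = begin
    nPart m (j ∸ 1) + suc t     ≤⟨ +-monoʳ-≤ (nPart m (j ∸ 1)) t<mj ⟩
    nPart m (j ∸ 1) + at m j    ≡⟨ nPart-step m j 1≤j ⟩
    nPart m j                   ≤⟨ nPart≤sum m j ⟩
    sum m                       ∎
    where open ≤-Reasoning

  0<at⇒1≤ : ∀ m j → 0 < at m j → 1 ≤ j
  0<at⇒1≤ (mj ∷ ms) (suc j) _ = s≤s z≤n

module Enumeration where
  open import Data.Bool using (Bool; true; false; T; if_then_else_)
  open import Data.Maybe as Maybe using (Maybe; just; nothing)
  open import Data.Maybe.Properties using (just-injective)
  open import Data.Nat using (ℕ; _+_; _≡ᵇ_)
  open import Data.Nat.Properties using (_≟_; +-identityʳ; +-assoc)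
  open import Data.List using (List; []; _∷_; map; concatMap; _++_; filterᵇ)
  open import Data.List.Properties using (≡-dec)
  open import Data.List.Membership.Propositional using (_∈_; _∉_)
  open import Data.List.Relation.Unary.Any using (here; there)
  open import Data.List.Relation.Unary.All as All using (All; []; _∷_)
  open import Data.List.Relation.Unary.All.Properties using (concat⁺; map⁺; All¬⇒¬Any)
  open import Data.List.Relation.Unary.AllPairs using (_∷_)
  open import Data.List.Relation.Unary.Unique.Propositional using (Unique)
  open import Data.List.Relation.Binary.Permutation.Propositional
    using (_↭_; ↭-refl; ↭-sym; ↭-trans; prep; swap)
  open import Data.List.Relation.Binary.Permutation.Propositional.Properties
    using (∈-resp-↭; ↭-length; drop-∷)
  open import Data.Product using (_×_; _,_; ∃)
  open import Data.Sum using (_⊎_; inj₁; inj₂)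
  open import Relation.Nullary using (¬_; yes; no; does)
  open import Relation.Nullary.Decidable using (dec-true; dec-false)
  open import Relation.Nullary.Negation using (contradiction)
  open import Relation.Binary.PropositionalEquality
  open import Relation.Binary.Definitions using (DecidableEquality)
  open import Function using (_∘_; case_of_)

  _≟ₗ_ : DecidableEquality (List ℕ)
  _≟ₗ_ = ≡-dec _≟_

  δ : List ℕ → List ℕ → ℕ
  δ τ ρ = if does (τ ≟ₗ ρ) then 1 else 0

  count : List ℕ → List (List ℕ) → ℕ
  count ρ []      = 0
  count ρ (τ ∷ L) = δ τ ρ + count ρ L

  δ-≢ : ∀ {τ ρ} → τ ≢ ρ → δ τ ρ ≡ 0
  δ-≢ τ≢ρ rewrite dec-false (_ ≟ₗ _) τ≢ρ = refl

  δ-∷ : ∀ a τ ρ → δ (a ∷ τ) (a ∷ ρ) ≡ δ τ ρ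
  δ-∷ a τ ρ rewrite dec-true (a ≟ a) refl = refl

  δ-∷-≢ : ∀ {a b} τ ρ → a ≢ b → δ (a ∷ τ) (b ∷ ρ) ≡ 0
  δ-∷-≢ τ ρ a≢b rewrite dec-false (_ ≟ _) a≢b = refl

  count-++ : ∀ ρ L M → count ρ (L ++ M) ≡ count ρ L + count ρ M
  count-++ ρ []      M = refl
  count-++ ρ (τ ∷ L) M = trans (cong (δ τ ρ +_) (count-++ ρ L M)) (sym (+-assoc (δ τ ρ) _ _))

  countᴹ : Maybe (List ℕ) → List (List ℕ) → ℕ
  countᴹ nothing  L = 0
  countᴹ (just ρ) L = count ρ L

  countᴹ-∷ : ∀ d τ L → countᴹ d (τ ∷ L) ≡ countᴹ d (τ ∷ []) + countᴹ d L
  countᴹ-∷ nothing  τ L = refl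
  countᴹ-∷ (just ρ) τ L = cong (_+ count ρ L) (sym (+-identityʳ (δ τ ρ)))

  countᴹ-map-∷ : ∀ b d τ → countᴹ (Maybe.map (b ∷_) d) ((b ∷ τ) ∷ []) ≡ countᴹ d (τ ∷ [])
  countᴹ-map-∷ b nothing  τ = refl
  countᴹ-map-∷ b (just ρ) τ = cong (_+ 0) (δ-∷ b τ ρ)

  countᴹ-map-∷-≢ : ∀ {b c} d τ → b ≢ c → countᴹ (Maybe.map (c ∷_) d) ((b ∷ τ) ∷ []) ≡ 0
  countᴹ-map-∷-≢ nothing  τ b≢c = refl
  countᴹ-map-∷-≢ (just ρ) τ b≢c = cong (_+ 0) (δ-∷-≢ τ ρ b≢c)

  countᴹ-map-∷-[] : ∀ b d → countᴹ (Maybe.map (b ∷_) d) ([] ∷ []) ≡ 0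
  countᴹ-map-∷-[] b nothing  = refl
  countᴹ-map-∷-[] b (just ρ) = refl

  count-map-∷ : ∀ b ρ L → count (b ∷ ρ) (map (b ∷_) L) ≡ count ρ L
  count-map-∷ b ρ []      = refl
  count-map-∷ b ρ (τ ∷ L) = cong₂ _+_ (δ-∷ b τ ρ) (count-map-∷ b ρ L)

  count-map-∷-≢ : ∀ {b c} ρ L → b ≢ c → count (c ∷ ρ) (map (b ∷_) L) ≡ 0
  count-map-∷-≢ ρ []      b≢c = refl
  count-map-∷-≢ ρ (τ ∷ L) b≢c = cong₂ _+_ (δ-∷-≢ τ ρ b≢c) (count-map-∷-≢ ρ L b≢c)

  count-map-∷-[] : ∀ b L → count [] (map (b ∷_) L) ≡ 0
  count-map-∷-[] b []      = refl
  count-map-∷-[] b (τ ∷ L) = count-map-∷-[] b L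

  deleteFirst : ℕ → List ℕ → Maybe (List ℕ)
  deleteFirst a []      = nothing
  deleteFirst a (b ∷ ρ) = if a ≡ᵇ b then just ρ else Maybe.map (b ∷_) (deleteFirst a ρ)

  deleteFirst-≡ : ∀ a ρ → deleteFirst a (a ∷ ρ) ≡ just ρ
  deleteFirst-≡ a ρ rewrite dec-true (a ≟ a) refl = refl

  deleteFirst-≢ : ∀ {a b} ρ → a ≢ b → deleteFirst a (b ∷ ρ) ≡ Maybe.map (b ∷_) (deleteFirst a ρ)
  deleteFirst-≢ ρ a≢b rewrite dec-false (_ ≟ _) a≢b = refl

  deleteFirst-↭ : ∀ a ρ {ρ'} → deleteFirst a ρ ≡ just ρ' → ρ ↭ a ∷ ρ'
  deleteFirst-↭ a (b ∷ ρ) eq with a ≟ b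
  ... | yes refl = subst (λ ρ' → a ∷ ρ ↭ a ∷ ρ') (just-injective (trans (sym (deleteFirst-≡ a ρ)) eq)) ↭-refl
  ... | no a≢b with deleteFirst a ρ in eq' | trans (sym (deleteFirst-≢ ρ a≢b)) eq
  ...   | just _ | refl = ↭-trans (prep b (deleteFirst-↭ a ρ eq')) (swap b a ↭-refl)

  deleteFirst-∈ : ∀ {a ρ} → a ∈ ρ → ∃ λ ρ' → deleteFirst a ρ ≡ just ρ'
  deleteFirst-∈ {a} {b ∷ ρ} a∈ with a ≟ b | a∈
  ... | yes refl | _          = ρ , deleteFirst-≡ a ρ
  ... | no a≢b   | here a≡b   = contradiction a≡b a≢b
  ... | no a≢b   | there a∈ρ  with deleteFirst-∈ a∈ρ
  ...   | ρ' , eq = b ∷ ρ' , trans (deleteFirst-≢ ρ a≢b) (cong (Maybe.map (b ∷_)) eq)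

  count-insertAll : ∀ a r ρ → a ∉ r → count ρ (insertAll a r) ≡ countᴹ (deleteFirst a ρ) (r ∷ [])
  count-insertAll a []      []      _ = refl
  count-insertAll a []      (b ∷ ρ) _ with a ≟ b
  ... | yes refl rewrite deleteFirst-≡ a ρ = cong (_+ 0) (δ-∷ a [] ρ)
  ... | no a≢b   rewrite deleteFirst-≢ ρ a≢b =
    trans (cong (_+ 0) (δ-∷-≢ [] ρ a≢b)) (sym (countᴹ-map-∷-[] b (deleteFirst a ρ)))
  count-insertAll a (b ∷ r) []      _ = count-map-∷-[] b (insertAll a r)
  count-insertAll a (b ∷ r) (c ∷ ρ) a∉b∷r with a ≟ b | c ≟ a | c ≟ b
  ... | yes a≡b | _        | _        = contradiction (here a≡b) a∉b∷r
  ... | no a≢b  | yes refl | _        rewrite deleteFirst-≡ a ρ =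
    cong₂ _+_ (δ-∷ a (b ∷ r) ρ) (count-map-∷-≢ ρ (insertAll a r) (a≢b ∘ sym))
  ... | no a≢b  | no c≢a   | yes refl rewrite deleteFirst-≢ ρ (c≢a ∘ sym) = begin
    δ (a ∷ c ∷ r) (c ∷ ρ) + count (c ∷ ρ) (map (c ∷_) (insertAll a r))
      ≡⟨ cong₂ _+_ (δ-∷-≢ (c ∷ r) ρ a≢b) (count-map-∷ c ρ (insertAll a r)) ⟩
    count ρ (insertAll a r)
      ≡⟨ count-insertAll a r ρ (a∉b∷r ∘ there) ⟩
    countᴹ (deleteFirst a ρ) (r ∷ [])
      ≡⟨ countᴹ-map-∷ c (deleteFirst a ρ) r ⟨
    countᴹ (Maybe.map (c ∷_) (deleteFirst a ρ)) ((c ∷ r) ∷ []) ∎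
    where open ≡-Reasoning
  ... | no a≢b  | no c≢a   | no c≢b   rewrite deleteFirst-≢ ρ (c≢a ∘ sym) =
    trans (cong₂ _+_ (δ-∷-≢ (b ∷ r) ρ (c≢a ∘ sym)) (count-map-∷-≢ ρ (insertAll a r) (c≢b ∘ sym)))
          (sym (countᴹ-map-∷-≢ (deleteFirst a ρ) r (c≢b ∘ sym)))

  count-concatMap-insertAll : ∀ a ρ L → All (a ∉_) L →
                              count ρ (concatMap (insertAll a) L) ≡ countᴹ (deleteFirst a ρ) L
  count-concatMap-insertAll a ρ [] [] with deleteFirst a ρ
  ... | nothing = refl
  ... | just _  = refl
  count-concatMap-insertAll a ρ (r ∷ L) (a∉r ∷ a∉L) = begin
    count ρ (insertAll a r ++ concatMap (insertAll a) L)
      ≡⟨ count-++ ρ (insertAll a r) _ ⟩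
    count ρ (insertAll a r) + count ρ (concatMap (insertAll a) L)
      ≡⟨ cong₂ _+_ (count-insertAll a r ρ a∉r) (count-concatMap-insertAll a ρ L a∉L) ⟩
    countᴹ (deleteFirst a ρ) (r ∷ []) + countᴹ (deleteFirst a ρ) L
      ≡⟨ countᴹ-∷ (deleteFirst a ρ) r L ⟨
    countᴹ (deleteFirst a ρ) (r ∷ L) ∎
    where open ≡-Reasoning

  insertAll-↭ : ∀ a r → All (_↭ a ∷ r) (insertAll a r)
  insertAll-↭ a []      = ↭-refl ∷ []
  insertAll-↭ a (b ∷ r) = ↭-refl ∷ map⁺ (All.map (λ p → ↭-trans (prep b p) (swap b a ↭-refl)) (insertAll-↭ a r))

  perms-↭ : ∀ L → All (_↭ L) (perms L)
  perms-↭ []      = ↭-refl ∷ []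
  perms-↭ (a ∷ r) = concat⁺ (map⁺ (All.map (λ r'↭r → All.map (λ p → ↭-trans p (prep a r'↭r)) (insertAll-↭ a _)) (perms-↭ r)))

  count-perms-∷ : ∀ a r ρ → a ∉ r → count ρ (perms (a ∷ r)) ≡ countᴹ (deleteFirst a ρ) (perms r)
  count-perms-∷ a r ρ a∉r = count-concatMap-insertAll a ρ (perms r) (All.map a∉ (perms-↭ r))
    where
    a∉ : ∀ {r'} → r' ↭ r → a ∉ r'
    a∉ r'↭r = a∉r ∘ ∈-resp-↭ r'↭r

  count-perms : ∀ L → Unique L → ∀ ρ →
                (ρ ↭ L × count ρ (perms L) ≡ 1) ⊎ (¬ (ρ ↭ L) × count ρ (perms L) ≡ 0)
  count-perms []      _ []      = inj₁ (↭-refl , refl)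
  count-perms []      _ (b ∷ ρ) = inj₂ ((λ p → case ↭-length p of λ ()) , refl)
  count-perms (a ∷ r) (a≢r ∷ ur) ρ with deleteFirst a ρ in eq | count-perms-∷ a r ρ (All¬⇒¬Any a≢r)
  ... | nothing | count≡ = inj₂ (¬↭ , count≡)
    where
    ¬↭ : ¬ (ρ ↭ a ∷ r)
    ¬↭ p with _ , eq' ← deleteFirst-∈ (∈-resp-↭ (↭-sym p) (here refl)) = case trans (sym eq) eq' of λ ()
  ... | just ρ' | count≡ with count-perms r ur ρ'
  ...   | inj₁ (ρ'↭r , c≡1)  = inj₁ (↭-trans (deleteFirst-↭ a ρ eq) (prep a ρ'↭r) , trans count≡ c≡1)
  ...   | inj₂ (¬ρ'↭r , c≡0) = inj₂ (¬ρ'↭r ∘ drop-∷ ∘ ↭-trans (↭-sym (deleteFirst-↭ a ρ eq)) , trans count≡ c≡0)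

  module _ (p : List ℕ → Bool) where

    count-filter-accept : ∀ {ρ} L → T (p ρ) → count ρ (filterᵇ p L) ≡ count ρ L
    count-filter-accept []      _  = refl
    count-filter-accept {ρ} (τ ∷ L) pρ with p τ in pτ≡
    ... | true  = cong (δ τ ρ +_) (count-filter-accept L pρ)
    ... | false = trans (count-filter-accept L pρ) (cong (_+ count ρ L) (sym (δ-≢ τ≢ρ)))
      where τ≢ρ : τ ≢ ρ
            τ≢ρ refl = subst T pτ≡ pρ

    count-filter-reject : ∀ {ρ} L → ¬ T (p ρ) → count ρ (filterᵇ p L) ≡ 0
    count-filter-reject []      _   = refl
    count-filter-reject {ρ} (τ ∷ L) ¬pρ with p τ in pτ≡
    ... | true  = cong₂ _+_ (δ-≢ τ≢ρ) (count-filter-reject L ¬pρ)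
      where τ≢ρ : τ ≢ ρ
            τ≢ρ refl = ¬pρ (subst T (sym pτ≡) _)
    ... | false = count-filter-reject L ¬pρ

module Young where
  open Positions
  open Blocks
  open Enumeration
  open import Data.Bool using (Bool; T)
  open import Data.Bool.Properties using (T?)
  open import Data.Nat using (ℕ; suc; _≤_; z≤n; s≤s; _≡ᵇ_)
  open import Data.Nat.Properties using (<⇒≢; n≤1+n; ≤-trans; ≡ᵇ⇒≡; ≡⇒≡ᵇ)
  open import Data.List using (List; length; all)
  open import Data.Nat.ListAction using (sum)
  open import Data.List.Properties using (length-applyUpTo)
  open import Data.List.Membership.Propositional using (_∈_)
  open import Data.List.Membership.Propositional.Properties using (∈-applyUpTo⁺; ∈-applyUpTo⁻)
  open import Data.List.Relation.Unary.All as All using (All)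
  open import Data.List.Relation.Unary.All.Properties using (all⁺; all⁻; all-filter; filter⁺)
  open import Data.List.Relation.Unary.Unique.Propositional using (Unique)
  open import Data.List.Relation.Unary.Unique.Propositional.Properties using (applyUpTo⁺₁)
  open import Data.List.Relation.Binary.Permutation.Propositional using (_↭_; ↭-trans; ↭-sym; ↭⇒↭ₛ)
  open import Data.List.Relation.Binary.Permutation.Propositional.Properties using (↭-length; ∈-resp-↭)
  open import Data.Product using (_×_; _,_)
  open import Data.Sum using (_⊎_; inj₁; inj₂)
  open import Relation.Nullary using (¬_; yes; no)
  open import Relation.Binary.PropositionalEquality
  open import Data.List.Relation.Binary.Permutation.Setoid.Properties (setoid ℕ) using (Unique-resp-↭)
  open import Function using (_∘_)

  ∈-oneTo⁺ : ∀ {n a} → 1 ≤ a → a ≤ n → a ∈ oneTo n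
  ∈-oneTo⁺ {a = suc a} _ a<n = ∈-applyUpTo⁺ suc a<n

  ∈-oneTo⁻ : ∀ {n a} → a ∈ oneTo n → 1 ≤ a × a ≤ n
  ∈-oneTo⁻ a∈ with _ , i<n , refl ← ∈-applyUpTo⁻ suc a∈ = s≤s z≤n , i<n

  length-oneTo : ∀ n → length (oneTo n) ≡ n
  length-oneTo = length-applyUpTo suc

  oneTo-unique : ∀ n → Unique (oneTo n)
  oneTo-unique n = applyUpTo⁺₁ suc n (λ i<j _ → <⇒≢ (s≤s i<j))

  rearrangement-unique : ∀ {ρ n} → ρ ↭ oneTo n → Unique ρ
  rearrangement-unique {n = n} ρ↭ = Unique-resp-↭ (↭⇒↭ₛ (↭-sym ρ↭)) (oneTo-unique n)

  record BlockPerm (m : List ℕ) (τ : List ℕ) : Set where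
    field
      perm      : τ ↭ oneTo (sum m)
      preserves : ∀ {a} → 1 ≤ a → a ≤ sum m → blk m (at τ a) ≡ blk m a

    length≡ : length τ ≡ sum m
    length≡ = trans (↭-length perm) (length-oneTo (sum m))

    at-range : ∀ {p} → 1 ≤ p → p ≤ sum m → 1 ≤ at τ p × at τ p ≤ sum m
    at-range 1≤p p≤n = ∈-oneTo⁻ (∈-resp-↭ perm (at-∈ τ 1≤p (subst (_ ≤_) (sym length≡) p≤n)))

  module _ (m : List ℕ) where
    private
      n = sum m
      preservesᵇ : List ℕ → Bool
      preservesᵇ τ = all (λ a → blk m (at τ a) ≡ᵇ blk m a) (oneTo n)

      preservesᵇ⁻ : ∀ {τ} → T (preservesᵇ τ) → ∀ {a} → 1 ≤ a → a ≤ n → blk m (at τ a) ≡ blk m a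
      preservesᵇ⁻ {τ} ok 1≤a a≤n = ≡ᵇ⇒≡ _ _ (All.lookup (all⁺ _ (oneTo n) ok) (∈-oneTo⁺ 1≤a a≤n))

      preservesᵇ⁺ : ∀ {τ} → (∀ {a} → 1 ≤ a → a ≤ n → blk m (at τ a) ≡ blk m a) → T (preservesᵇ τ)
      preservesᵇ⁺ {τ} p = all⁻ _ (All.tabulate λ a∈ → let (1≤a , a≤n) = ∈-oneTo⁻ a∈ in ≡⇒≡ᵇ _ _ (p 1≤a a≤n))

    Sm-BlockPerm : All (BlockPerm m) (Sm m)
    Sm-BlockPerm = All.zipWith (λ {τ} (p , ok) → record { perm = p ; preserves = preservesᵇ⁻ {τ} ok })
                     (filter⁺ (T? ∘ preservesᵇ) (perms-↭ (oneTo n)) , all-filter (T? ∘ preservesᵇ) (perms (oneTo n)))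

    count-Sm : ∀ ρ → (BlockPerm m ρ × count ρ (Sm m) ≡ 1) ⊎ (¬ BlockPerm m ρ × count ρ (Sm m) ≡ 0)
    count-Sm ρ with T? (preservesᵇ ρ) | count-perms (oneTo n) (oneTo-unique n) ρ
    ... | yes ok | inj₁ (ρ↭ , c≡1) =
      inj₁ (record { perm = ρ↭ ; preserves = preservesᵇ⁻ {ρ} ok } , trans (accept ok) c≡1)
      where accept = count-filter-accept preservesᵇ {ρ} (perms (oneTo n))
    ... | yes ok | inj₂ (¬ρ↭ , c≡0) =
      inj₂ (¬ρ↭ ∘ BlockPerm.perm , trans (accept ok) c≡0)
      where accept = count-filter-accept preservesᵇ {ρ} (perms (oneTo n))
    ... | no ¬ok | _ =
      inj₂ (¬ok ∘ preservesᵇ⁺ {ρ} ∘ BlockPerm.preserves , count-filter-reject preservesᵇ {ρ} (perms (oneTo n)) ¬ok)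

  record SameBlock (m : List ℕ) (a : ℕ) : Set where
    field
      1≤a   : 1 ≤ a
      a+1≤n : suc a ≤ sum m
      blk≡  : blk m a ≡ blk m (suc a)

  module _ {m a} (s : SameBlock m a) where
    open SameBlock s

    blk-swapVal : ∀ x → blk m (swapVal a x) ≡ blk m x
    blk-swapVal x with swapValView a x
    ... | left  = trans (cong (blk m) (swapVal-left a)) (sym blk≡)
    ... | right = trans (cong (blk m) (swapVal-right a)) blk≡
    ... | other x≢a x≢a+1 = cong (blk m) (swapVal-other a x≢a x≢a+1)

    swapVal-range : ∀ {x} → 1 ≤ x → x ≤ sum m → 1 ≤ swapVal a x × swapVal a x ≤ sum m
    swapVal-range {x} 1≤x x≤n with swapValView a x
    ... | left  rewrite swapVal-left a  = s≤s z≤n , a+1≤n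
    ... | right rewrite swapVal-right a = 1≤a , ≤-trans (n≤1+n a) a+1≤n
    ... | other x≢a x≢a+1 rewrite swapVal-other a x≢a x≢a+1 = 1≤x , x≤n

    BlockPerm-swapAt : ∀ {τ} → BlockPerm m τ → BlockPerm m (swapAt a τ)
    BlockPerm-swapAt {τ} bp = record
      { perm      = ↭-trans (swapAt-↭ a τ) perm
      ; preserves = λ {x} 1≤x x≤n → let (1≤x' , x'≤n) = swapVal-range 1≤x x≤n in begin
          blk m (at (swapAt a τ) x)      ≡⟨ cong (blk m) (at-swapAt a τ 1≤a (subst (suc a ≤_) (sym length≡) a+1≤n) x) ⟩
          blk m (at τ (swapVal a x))     ≡⟨ preserves 1≤x' x'≤n ⟩
          blk m (swapVal a x)            ≡⟨ blk-swapVal x ⟩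
          blk m x                        ∎
      }
      where open BlockPerm bp
            open ≡-Reasoning

    ¬BlockPerm-swapAt : ∀ {τ} → ¬ BlockPerm m τ → ¬ BlockPerm m (swapAt a τ)
    ¬BlockPerm-swapAt {τ} ¬bp = ¬bp ∘ subst (BlockPerm m) (swapAt-involutive a τ) ∘ BlockPerm-swapAt

module Inversions where
  open Positions
  open Young using (SameBlock; module SameBlock; blk-swapVal)
  open import Data.Bool using (if_then_else_; _∧_)
  open import Data.Nat using (ℕ; zero; suc; _+_; _∸_; _≤_; _<_; s≤s; z<s; _≡ᵇ_; _<ᵇ_)
  open import Data.Nat.Properties
  open import Data.List using (List; map; length; applyUpTo)
  open import Data.Nat.ListAction using (sum)
  open import Data.Sum using (inj₁; inj₂)
  open import Data.Empty using (⊥-elim)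
  open import Relation.Binary.PropositionalEquality
  open import Function using (_∘_)
  open import Data.Nat.Tactic.RingSolver using (solve-∀)
  open import Algebra.Properties.CommutativeSemigroup +-commutativeSemigroup using (x∙yz≈y∙xz)

  sumFrom : ℕ → ℕ → (ℕ → ℕ) → ℕ
  sumFrom s zero    f = 0
  sumFrom s (suc l) f = f s + sumFrom (suc s) l f

  sum-map-applyUpTo : ∀ (f g : ℕ → ℕ) s l → (∀ i → g i ≡ s + i) → sum (map f (applyUpTo g l)) ≡ sumFrom s l f
  sum-map-applyUpTo f g s zero    g≡ = refl
  sum-map-applyUpTo f g s (suc l) g≡ =
    cong₂ _+_ (cong f (trans (g≡ 0) (+-identityʳ s)))
              (sum-map-applyUpTo f (g ∘ suc) (suc s) l (λ i → trans (g≡ (suc i)) (+-suc s i)))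

  sumFrom-cong : ∀ s l {f g : ℕ → ℕ} → (∀ {y} → s ≤ y → y < s + l → f y ≡ g y) → sumFrom s l f ≡ sumFrom s l g
  sumFrom-cong s zero    f≡g = refl
  sumFrom-cong s (suc l) f≡g =
    cong₂ _+_ (f≡g ≤-refl (m<m+n s z<s))
              (sumFrom-cong (suc s) l (λ {y} s<y y<s+l → f≡g (<⇒≤ s<y) (subst (y <_) (sym (+-suc s l)) y<s+l)))

  sumFrom-+ : ∀ s l₁ l₂ f → sumFrom s (l₁ + l₂) f ≡ sumFrom s l₁ f + sumFrom (s + l₁) l₂ f
  sumFrom-+ s zero     l₂ f = cong (λ t → sumFrom t l₂ f) (sym (+-identityʳ s))
  sumFrom-+ s (suc l₁) l₂ f = trans (cong (f s +_) (trans (sumFrom-+ (suc s) l₁ l₂ f)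
    (cong (λ t → sumFrom (suc s) l₁ f + sumFrom t l₂ f) (sym (+-suc s l₁))))) (sym (+-assoc (f s) _ _))

  swapVal-below : ∀ a {y} → y < a → swapVal a y ≡ y
  swapVal-below a y<a = swapVal-other a (<⇒≢ y<a) (<⇒≢ (≤-trans y<a (n≤1+n a)))

  swapVal-above : ∀ a {y} → suc a < y → swapVal a y ≡ y
  swapVal-above a a+1<y = swapVal-other a (>⇒≢ (<-trans (n<1+n a) a+1<y)) (>⇒≢ a+1<y)

  sumFrom-swapVal : ∀ a s l f → s ≤ a → suc a < s + l → sumFrom s l (f ∘ swapVal a) ≡ sumFrom s l f
  sumFrom-swapVal a s zero f s≤a a+1<s = ⊥-elim (<-irrefl refl (<-≤-trans (<-trans (n<1+n a) (subst (_ <_) (+-identityʳ s) a+1<s)) s≤a))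
  sumFrom-swapVal a s (suc l) f s≤a a+1<s+l with m≤n⇒m<n∨m≡n s≤a
  ... | inj₁ s<a = cong₂ _+_ (cong f (swapVal-below a s<a))
                             (sumFrom-swapVal a (suc s) l f s<a (subst (suc a <_) (+-suc s l) a+1<s+l))
  sumFrom-swapVal a s (suc zero) f _ a+1<s+1 | inj₂ refl = ⊥-elim (<-irrefl (+-comm 1 s) a+1<s+1)
  sumFrom-swapVal a s (suc (suc l)) f _ _    | inj₂ refl = begin
    f (swapVal a a) + (f (swapVal a (suc a)) + sumFrom (suc (suc a)) l (f ∘ swapVal a))
      ≡⟨ cong₂ _+_ (cong f (swapVal-left a)) (cong₂ _+_ (cong f (swapVal-right a))
           (sumFrom-cong (suc (suc a)) l (λ a+1<y _ → cong f (swapVal-above a a+1<y)))) ⟩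
    f (suc a) + (f a + sumFrom (suc (suc a)) l f)
      ≡⟨ x∙yz≈y∙xz (f (suc a)) (f a) _ ⟩
    f a + (f (suc a) + sumFrom (suc (suc a)) l f) ∎
    where open ≡-Reasoning

  inverted : List ℕ → List ℕ → ℕ → ℕ → ℕ
  inverted m τ x y = if (blk m x ≡ᵇ blk m y) ∧ (at τ y <ᵇ at τ x) then 1 else 0

  invRow : List ℕ → List ℕ → ℕ → ℕ
  invRow m τ x = sumFrom (suc x) (sum m ∸ x) (inverted m τ x)

  invm-rows : ∀ m τ → invm m τ ≡ sumFrom 1 (sum m) (invRow m τ)
  invm-rows m τ = trans (sum-map-applyUpTo _ suc 1 (sum m) (λ _ → refl))
    (sumFrom-cong 1 (sum m) λ {x} _ _ → sum-map-applyUpTo (inverted m τ x) _ (suc x) (sum m ∸ x) (+-suc x))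

  module _ {m a} (s : SameBlock m a) {τ} (len : suc a ≤ length τ) (asc : at τ a < at τ (suc a)) where
    open SameBlock s
    private
      n  = sum m
      τ' = swapAt a τ
      k  = n ∸ suc a
      n∸a≡ : n ∸ a ≡ suc k
      n∸a≡ = +-∸-assoc 1 a+1≤n

    inverted-swapAt : ∀ x y → inverted m τ' x y ≡ inverted m τ (swapVal a x) (swapVal a y)
    inverted-swapAt x y = cong (λ b → if b then 1 else 0) (cong₂ _∧_
      (cong₂ _≡ᵇ_ (sym (blk-swapVal s x)) (sym (blk-swapVal s y)))
      (cong₂ _<ᵇ_ (at-swapAt a τ 1≤a len y) (at-swapAt a τ 1≤a len x)))

    inverted-ascent : inverted m τ a (suc a) ≡ 0
    inverted-ascent rewrite blk≡ | ≡ᵇ-≡ {blk m (suc a)} refl | <ᵇ-≥ (<⇒≤ asc) = refl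

    inverted-descent : inverted m τ (suc a) a ≡ 1
    inverted-descent rewrite blk≡ | ≡ᵇ-≡ {blk m (suc a)} refl | <ᵇ-< asc = refl


    invRow-below : ∀ {x} → x < a → invRow m τ' x ≡ invRow m τ x
    invRow-below {x} x<a = begin
      sumFrom (suc x) (n ∸ x) (inverted m τ' x)                    ≡⟨ sumFrom-cong (suc x) (n ∸ x) (λ _ _ → inverted-swapAt x _) ⟩
      sumFrom (suc x) (n ∸ x) (inverted m τ (swapVal a x) ∘ swapVal a) ≡⟨ cong (λ z → sumFrom (suc x) (n ∸ x) (inverted m τ z ∘ swapVal a)) (swapVal-below a x<a) ⟩
      sumFrom (suc x) (n ∸ x) (inverted m τ x ∘ swapVal a)          ≡⟨ sumFrom-swapVal a (suc x) (n ∸ x) _ x<a (s≤s a+1≤x+[n∸x]) ⟩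
      sumFrom (suc x) (n ∸ x) (inverted m τ x)                      ∎
      where open ≡-Reasoning
            a+1≤x+[n∸x] : suc a ≤ x + (n ∸ x)
            a+1≤x+[n∸x] = subst (suc a ≤_) (sym (m+[n∸m]≡n (≤-trans (<⇒≤ x<a) (≤-trans (n≤1+n a) a+1≤n)))) a+1≤n

    invRow-above : ∀ {x} → suc a < x → invRow m τ' x ≡ invRow m τ x
    invRow-above {x} a+1<x = sumFrom-cong (suc x) (n ∸ x) λ x<y _ →
      trans (inverted-swapAt x _) (cong₂ (inverted m τ) (swapVal-above a a+1<x) (swapVal-above a (<-trans a+1<x x<y)))

    invRow-at-a : invRow m τ' a ≡ suc (invRow m τ (suc a))
    invRow-at-a = begin
      sumFrom (suc a) (n ∸ a) (inverted m τ' a)                      ≡⟨ cong (λ l → sumFrom (suc a) l (inverted m τ' a)) n∸a≡ ⟩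
      inverted m τ' a (suc a) + sumFrom (suc (suc a)) k (inverted m τ' a)
        ≡⟨ cong₂ _+_ (trans (inverted-swapAt a (suc a)) (trans (cong₂ (inverted m τ) (swapVal-left a) (swapVal-right a)) inverted-descent))
                     (sumFrom-cong (suc (suc a)) k λ a+1<y _ →
                        trans (inverted-swapAt a _) (cong₂ (inverted m τ) (swapVal-left a) (swapVal-above a a+1<y))) ⟩
      suc (invRow m τ (suc a))                                         ∎
      where open ≡-Reasoning

    invRow-at-a+1 : invRow m τ' (suc a) ≡ invRow m τ a
    invRow-at-a+1 = begin
      sumFrom (suc (suc a)) k (inverted m τ' (suc a))
        ≡⟨ sumFrom-cong (suc (suc a)) k (λ a+1<y _ →
             trans (inverted-swapAt (suc a) _) (cong₂ (inverted m τ) (swapVal-right a) (swapVal-above a a+1<y))) ⟩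
      sumFrom (suc (suc a)) k (inverted m τ a)                         ≡⟨ cong (_+ sumFrom (suc (suc a)) k (inverted m τ a)) inverted-ascent ⟨
      inverted m τ a (suc a) + sumFrom (suc (suc a)) k (inverted m τ a) ≡⟨ cong (λ l → sumFrom (suc a) l (inverted m τ a)) n∸a≡ ⟨
      invRow m τ a                                                     ∎
      where open ≡-Reasoning

    -- Moving an ascent at a, a + 1 inside a block creates exactly the inversion (a, a + 1).
    invm-swapAt : invm m τ' ≡ suc (invm m τ)
    invm-swapAt = begin
      invm m τ'                                                         ≡⟨ invm-rows m τ' ⟩
      sumFrom 1 n (invRow m τ')                                          ≡⟨ split τ' ⟩
      sumFrom 1 a₀ (invRow m τ') + (invRow m τ' a + (invRow m τ' (suc a) + sumFrom (suc (suc a)) k (invRow m τ')))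
        ≡⟨ cong₂ _+_ (sumFrom-cong 1 a₀ λ {x} _ x<a → invRow-below (subst (x <_) a≡ x<a))
             (cong₂ _+_ invRow-at-a (cong₂ _+_ invRow-at-a+1 (sumFrom-cong (suc (suc a)) k λ {x} a+1<x _ → invRow-above {x} a+1<x))) ⟩
      A + (suc B + (C + D))                                              ≡⟨ rearrange A B C D ⟩
      suc (A + (C + (B + D)))                                            ≡⟨ cong suc (split τ) ⟨
      suc (sumFrom 1 n (invRow m τ))                                     ≡⟨ cong suc (invm-rows m τ) ⟨
      suc (invm m τ)                                                     ∎
      where
      open ≡-Reasoning
      a₀ = a ∸ 1
      a≡ : 1 + a₀ ≡ a
      a≡ = m+[n∸m]≡n 1≤a
      A = sumFrom 1 a₀ (invRow m τ)
      B = invRow m τ (suc a)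
      C = invRow m τ a
      D = sumFrom (suc (suc a)) k (invRow m τ)
      n≡ : n ≡ a₀ + (2 + k)
      n≡ = begin
        n                 ≡⟨ m+[n∸m]≡n a+1≤n ⟨
        suc a + k         ≡⟨ cong (λ t → suc t + k) a≡ ⟨
        2 + a₀ + k        ≡⟨ cong (_+ k) (+-comm 2 a₀) ⟩
        a₀ + 2 + k        ≡⟨ +-assoc a₀ 2 k ⟩
        a₀ + (2 + k)      ∎
      split : ∀ σ → sumFrom 1 n (invRow m σ) ≡
                    sumFrom 1 a₀ (invRow m σ) + (invRow m σ a + (invRow m σ (suc a)
                      + sumFrom (suc (suc a)) k (invRow m σ)))
      split σ = trans (cong (λ l → sumFrom 1 l (invRow m σ)) n≡)
                (trans (sumFrom-+ 1 a₀ (2 + k) (invRow m σ)) (cong (λ t → sumFrom 1 a₀ (invRow m σ) + sumFrom t (2 + k) (invRow m σ)) a≡))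
      rearrange : ∀ A B C D → A + (suc B + (C + D)) ≡ suc (A + (C + (B + D)))
      rearrange = solve-∀

module Standardization where
  open Positions
  open Blocks
  open import Data.Bool using (if_then_else_)
  open import Data.Nat using (ℕ; zero; suc; _+_; _∸_; _≤_; _<_; z≤n; s≤s; _≡ᵇ_)
  open import Data.Nat.Properties
  open import Data.List using (List; []; _∷_; length; filter; applyUpTo; _++_)
  open import Data.List.Properties using (filter-++; filter-all; filter-none; filter-accept; filter-reject; length-++; length-applyUpTo)
  open import Data.Nat.ListAction using (sum)
  open import Data.List.Relation.Unary.All as All using (All; []; _∷_)
  open import Data.List.Relation.Unary.All.Properties using (applyUpTo⁺₂; ++⁺)
  open import Data.List.Relation.Unary.AllPairs using ([]; _∷_)
  open import Data.List.Relation.Unary.Unique.Propositional using (Unique)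
  open import Data.List.Relation.Binary.Pointwise.Base as Pointwise using (Pointwise; []; _∷_)
  open import Data.List.Relation.Binary.Permutation.Propositional using (_↭_)
  open import Data.List.Relation.Binary.Permutation.Propositional.Properties using (filter-↭; ↭-length)
  open import Data.Empty using (⊥-elim)
  open import Relation.Nullary using (yes; no)
  open import Relation.Binary.PropositionalEquality
  open import Function using (_∘_)

  occ : ℕ → List ℕ → ℕ
  occ j w = length (filter (_≟ j) w)

  occ-≡ : ∀ j w → occ j (j ∷ w) ≡ suc (occ j w)
  occ-≡ j w = cong length (filter-accept (_≟ j) refl)

  occ-≢ : ∀ {j k} w → k ≢ j → occ j (k ∷ w) ≡ occ j w
  occ-≢ w k≢j = cong length (filter-reject (_≟ _) k≢j)

  occ-↭ : ∀ j {w w'} → w ↭ w' → occ j w ≡ occ j w'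
  occ-↭ j w↭w' = ↭-length (filter-↭ (_≟ j) w↭w')

  occ-++ : ∀ j u v → occ j (u ++ v) ≡ occ j u + occ j v
  occ-++ j u v = trans (cong length (filter-++ (_≟ j) u v)) (length-++ (filter (_≟ j) u))

  occ-replicate-≡ : ∀ s k → occ s (applyUpTo (λ _ → s) k) ≡ k
  occ-replicate-≡ s k = trans (cong length (filter-all (_≟ s) (applyUpTo⁺₂ _ k (λ _ → refl)))) (length-applyUpTo _ k)

  occ-replicate-≢ : ∀ {j s} k → s ≢ j → occ j (applyUpTo (λ _ → s) k) ≡ 0
  occ-replicate-≢ k s≢j = cong length (filter-none (_≟ _) (applyUpTo⁺₂ _ k (λ _ → s≢j)))

  baseWordAux-≥ : ∀ s ms → All (s ≤_) (baseWordAux s ms)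
  baseWordAux-≥ s []        = []
  baseWordAux-≥ s (mj ∷ ms) = ++⁺ (applyUpTo⁺₂ _ mj (λ _ → ≤-refl)) (All.map (≤-trans (n≤1+n s)) (baseWordAux-≥ (suc s) ms))

  occ-baseWordAux-< : ∀ {j s} ms → j < s → occ j (baseWordAux s ms) ≡ 0
  occ-baseWordAux-< {j} {s} ms j<s =
    cong length (filter-none (_≟ j) (All.map (λ s≤x x≡j → <⇒≱ j<s (subst (s ≤_) x≡j s≤x)) (baseWordAux-≥ s ms)))

  occ-baseWordAux : ∀ s ms t → occ (s + t) (baseWordAux s ms) ≡ at ms (suc t)
  occ-baseWordAux s []        t       = refl
  occ-baseWordAux s (mj ∷ ms) zero    = begin
    occ (s + 0) (applyUpTo (λ _ → s) mj ++ baseWordAux (suc s) ms)     ≡⟨ cong (λ j → occ j (applyUpTo (λ _ → s) mj ++ baseWordAux (suc s) ms)) (+-identityʳ s) ⟩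
    occ s (applyUpTo (λ _ → s) mj ++ baseWordAux (suc s) ms)           ≡⟨ occ-++ s (applyUpTo (λ _ → s) mj) _ ⟩
    occ s (applyUpTo (λ _ → s) mj) + occ s (baseWordAux (suc s) ms)    ≡⟨ cong₂ _+_ (occ-replicate-≡ s mj) (occ-baseWordAux-< ms (n<1+n s)) ⟩
    mj + 0                                                             ≡⟨ +-identityʳ mj ⟩
    mj                                                                 ∎
    where open ≡-Reasoning
  occ-baseWordAux s (mj ∷ ms) (suc t) = begin
    occ (s + suc t) (applyUpTo (λ _ → s) mj ++ baseWordAux (suc s) ms)
      ≡⟨ occ-++ (s + suc t) (applyUpTo (λ _ → s) mj) _ ⟩
    occ (s + suc t) (applyUpTo (λ _ → s) mj) + occ (s + suc t) (baseWordAux (suc s) ms)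
      ≡⟨ cong₂ _+_ (occ-replicate-≢ mj (<⇒≢ (m<m+n s (s≤s z≤n)))) (cong (λ j → occ j (baseWordAux (suc s) ms)) (+-suc s t)) ⟩
    0 + occ (suc s + t) (baseWordAux (suc s) ms)
      ≡⟨ occ-baseWordAux (suc s) ms t ⟩
    at ms (suc t) ∎
    where open ≡-Reasoning

  occ-baseWord : ∀ m j → occ j (baseWord m) ≡ at m j
  occ-baseWord m       (suc j) = occ-baseWordAux 1 m j
  occ-baseWord []      zero    = refl
  occ-baseWord (mj ∷ m) zero   = occ-baseWordAux-< {s = 1} (mj ∷ m) (s≤s z≤n)

  length-baseWordAux : ∀ s ms → length (baseWordAux s ms) ≡ sum ms
  length-baseWordAux s []        = refl
  length-baseWordAux s (mj ∷ ms) =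
    trans (length-++ (applyUpTo (λ _ → s) mj)) (cong₂ _+_ (length-applyUpTo _ mj) (length-baseWordAux (suc s) ms))

  length-baseWord : ∀ m → length (baseWord m) ≡ sum m
  length-baseWord = length-baseWordAux 1

  Pointwise-at : ∀ {R : ℕ → ℕ → Set} {xs ys} → Pointwise R xs ys → ∀ {p} → 1 ≤ p → p ≤ length xs → R (at xs p) (at ys p)
  Pointwise-at (r ∷ _)  {suc zero}    _ _       = r
  Pointwise-at (_ ∷ rs) {suc (suc p)} _ (s≤s l) = Pointwise-at rs (s≤s z≤n) l

  Pointwise-All : ∀ {R : ℕ → ℕ → Set} {P : ℕ → Set} {xs ys} → (∀ {x y} → R x y → P y) → Pointwise R xs ys → All P ys
  Pointwise-All f []       = []
  Pointwise-All f (r ∷ rs) = f r ∷ Pointwise-All f rs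

  module _ (m : List ℕ) where

    bump : (ℕ → ℕ) → ℕ → ℕ → ℕ
    bump c j k = if k ≡ᵇ j then suc (c k) else c k

    bump-≡ : ∀ c j → bump c j j ≡ suc (c j)
    bump-≡ c j rewrite ≡ᵇ-≡ {j} refl = refl

    bump-≢ : ∀ c {j k} → k ≢ j → bump c j k ≡ c k
    bump-≢ c k≢j rewrite ≡ᵇ-≢ k≢j = refl

    bump-≥ : ∀ c j k → c k ≤ bump c j k
    bump-≥ c j k with k ≟ j
    ... | yes refl = subst (c k ≤_) (sym (bump-≡ c k)) (n≤1+n (c k))
    ... | no k≢j   = ≤-reflexive (sym (bump-≢ c k≢j))

    bump-comm : ∀ c {j j'} → j ≢ j' → ∀ k → bump (bump c j) j' k ≡ bump (bump c j') j k
    bump-comm c {j} {j'} j≢j' k with k ≟ j | k ≟ j'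
    ... | yes refl | yes refl = ⊥-elim (j≢j' refl)
    ... | yes refl | no k≢j'  = begin
      bump (bump c k) j' k  ≡⟨ bump-≢ (bump c k) k≢j' ⟩
      bump c k k            ≡⟨ bump-≡ c k ⟩
      suc (c k)             ≡⟨ cong suc (bump-≢ c k≢j') ⟨
      suc (bump c j' k)     ≡⟨ bump-≡ (bump c j') k ⟨
      bump (bump c j') k k  ∎
      where open ≡-Reasoning
    ... | no k≢j   | yes refl = begin
      bump (bump c j) k k   ≡⟨ bump-≡ (bump c j) k ⟩
      suc (bump c j k)      ≡⟨ cong suc (bump-≢ c k≢j) ⟩
      suc (c k)             ≡⟨ bump-≡ c k ⟨
      bump c k k            ≡⟨ bump-≢ (bump c k) k≢j ⟨
      bump (bump c k) j k   ∎
      where open ≡-Reasoning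
    ... | no k≢j   | no k≢j'  = begin
      bump (bump c j) j' k  ≡⟨ bump-≢ (bump c j) k≢j' ⟩
      bump c j k            ≡⟨ bump-≢ c k≢j ⟩
      c k                   ≡⟨ bump-≢ c k≢j' ⟨
      bump c j' k           ≡⟨ bump-≢ (bump c j') k≢j ⟨
      bump (bump c j') j k  ∎
      where open ≡-Reasoning

    stdAux-cong : ∀ w {c c'} → (∀ k → c k ≡ c' k) → stdAux m w c ≡ stdAux m w c'
    stdAux-cong []      c≡c' = refl
    stdAux-cong (j ∷ w) c≡c' =
      cong₂ _∷_ (cong (slot m j) (c≡c' j)) (stdAux-cong w (λ k → cong (λ z → if k ≡ᵇ j then suc z else z) (c≡c' k)))

    length-stdAux : ∀ w c → length (stdAux m w c) ≡ length w
    length-stdAux []      c = refl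
    length-stdAux (j ∷ w) c = cong suc (length-stdAux w (bump c j))

    -- The counters c leave room in every block for the letters still to be read.
    Fits : List ℕ → (ℕ → ℕ) → Set
    Fits w c = ∀ k → c k + occ k w ≤ at m k

    Fits-bump : ∀ {j w c} → Fits (j ∷ w) c → Fits w (bump c j)
    Fits-bump {j} {w} {c} fits k with k ≟ j
    ... | yes refl = subst (_≤ at m k) (begin
          c k + occ k (k ∷ w)    ≡⟨ cong (c k +_) (occ-≡ k w) ⟩
          c k + suc (occ k w)    ≡⟨ +-suc (c k) (occ k w) ⟩
          suc (c k) + occ k w    ≡⟨ cong (_+ occ k w) (bump-≡ c k) ⟨
          bump c k k + occ k w   ∎) (fits k)
      where open ≡-Reasoning
    ... | no k≢j = subst (_≤ at m k) (cong₂ _+_ (sym (bump-≢ c k≢j)) (occ-≢ w (k≢j ∘ sym))) (fits k)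

    Fits-head : ∀ {j w c} → Fits (j ∷ w) c → c j < at m j
    Fits-head {j} {w} {c} fits =
      ≤-trans (s≤s (m≤m+n (c j) (occ j w))) (subst (_≤ at m j) (trans (cong (c j +_) (occ-≡ j w)) (+-suc (c j) _)) (fits j))

    Fits-baseWord : ∀ {w} → w ↭ baseWord m → Fits w (λ _ → 0)
    Fits-baseWord w↭ k = ≤-reflexive (trans (occ-↭ k w↭) (occ-baseWord m k))

    record SlotFrom (c : ℕ → ℕ) (j u : ℕ) : Set where
      field
        t     : ℕ
        lower : c j ≤ t
        upper : t < at m j
        value : u ≡ slot m j t

      1≤j : 1 ≤ j
      1≤j = 0<at⇒1≤ m j (≤-trans (s≤s z≤n) upper)

      blk≡ : blk m u ≡ j
      blk≡ = trans (cong (blk m) value) (blk-slot m j t 1≤j upper)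

      1≤u : 1 ≤ u
      1≤u = subst (1 ≤_) (sym value) (1≤slot m j t)

      u≤n : u ≤ sum m
      u≤n = subst (_≤ sum m) (sym value) (slot≤sum m j t 1≤j upper)

    SlotFrom-weaken : ∀ {c c'} → (∀ k → c k ≤ c' k) → ∀ {j u} → SlotFrom c' j u → SlotFrom c j u
    SlotFrom-weaken c≤c' {j} s = record { SlotFrom s; lower = ≤-trans (c≤c' j) (SlotFrom.lower s) }

    head-slot : ∀ {j w c} → Fits (j ∷ w) c → SlotFrom c j (slot m j (c j))
    head-slot {j} {w} {c} fits = record { t = c j ; lower = ≤-refl ; upper = Fits-head fits ; value = refl }

    stdAux-slots : ∀ w c → Fits w c → Pointwise (SlotFrom c) w (stdAux m w c)
    stdAux-slots []      c fits = []
    stdAux-slots (j ∷ w) c fits =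
      head-slot fits ∷ Pointwise.map (SlotFrom-weaken (bump-≥ c j)) (stdAux-slots w (bump c j) (Fits-bump fits))

    stdAux-unique : ∀ w c → Fits w c → Unique (stdAux m w c)
    stdAux-unique []      c fits = []
    stdAux-unique (j ∷ w) c fits =
      Pointwise-All head≢ (stdAux-slots w (bump c j) (Fits-bump fits)) ∷ stdAux-unique w (bump c j) (Fits-bump fits)
      where
      -- An equal value would lie in the block j, where later counters are strictly larger.
      head≢ : ∀ {k u} → SlotFrom (bump c j) k u → slot m j (c j) ≢ u
      head≢ {k} s v≡u with trans (sym (SlotFrom.blk≡ (head-slot {j} {w} {c} fits))) (trans (cong (blk m) v≡u) (SlotFrom.blk≡ s))
      ... | refl = <-irrefl (suc-injective (+-cancelˡ-≡ (nPart m (j ∸ 1)) _ _ (trans v≡u (SlotFrom.value s))))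
                     (<-≤-trans (subst (c j <_) (sym (bump-≡ c j)) (n<1+n (c j))) (SlotFrom.lower s))

    stdAux-swapAt : ∀ i w c → at w i ≢ at w (suc i) → stdAux m (swapAt i w) c ≡ swapAt i (stdAux m w c)
    stdAux-swapAt (suc zero) (j ∷ j' ∷ w) c j≢j' =
      cong₂ _∷_ (cong (slot m j') (sym (bump-≢ c (j≢j' ∘ sym))))
        (cong₂ _∷_ (cong (slot m j) (bump-≢ c j≢j')) (stdAux-cong w (bump-comm c (j≢j' ∘ sym))))
    stdAux-swapAt (suc (suc i)) (j ∷ w) c ne = cong (_ ∷_) (stdAux-swapAt (suc i) w (bump c j) ne)
    stdAux-swapAt zero          w            c _ = refl
    stdAux-swapAt (suc zero)    []           c _ = refl
    stdAux-swapAt (suc zero)    (j ∷ [])     c _ = refl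
    stdAux-swapAt (suc (suc i)) []           c _ = refl

    stdAux-consecutive : ∀ i w c → 1 ≤ i → suc i ≤ length w → at w i ≡ at w (suc i) →
                         at (stdAux m w c) (suc i) ≡ suc (at (stdAux m w c) i)
    stdAux-consecutive (suc zero)    (j ∷ j' ∷ w) c _ _ refl =
      trans (cong (slot m j) (bump-≡ c j)) (+-suc (nPart m (j ∸ 1)) (suc (c j)))
    stdAux-consecutive (suc zero)    (j ∷ [])     c _ (s≤s ()) _
    stdAux-consecutive (suc (suc i)) (j ∷ w)      c _ (s≤s l) e = stdAux-consecutive (suc i) w (bump c j) (s≤s z≤n) l e

  length-std : ∀ m w → length (std m w) ≡ length w
  length-std m w = length-stdAux m w (λ _ → 0)

  module _ {m w : List ℕ} (w↭ : w ↭ baseWord m) where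

    std-slot : ∀ {p} → 1 ≤ p → p ≤ length w → SlotFrom m (λ _ → 0) (at w p) (at (std m w) p)
    std-slot = Pointwise-at (stdAux-slots m w (λ _ → 0) (Fits-baseWord m w↭))

    std-unique : Unique (std m w)
    std-unique = stdAux-unique m w (λ _ → 0) (Fits-baseWord m w↭)

module FreeModule {c ℓ₁ ℓ₂} (F : OrderedField c ℓ₁ ℓ₂) where
  open Enumeration using (_≟ₗ_; count)
  open import Level using (_⊔_)
  open import Data.Bool using (if_then_else_)
  open import Data.Nat as ℕ using (ℕ; suc)
  import Data.Nat.Properties as ℕ
  open import Data.List using (List; []; _∷_; map; concat; length; _++_)
  open import Data.List.Relation.Unary.All as All using (All; []; _∷_)
  open import Data.List.Relation.Unary.All.Properties using (++⁺)
  open import Data.Product as Product using (_,_; proj₂)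
  open import Data.List.Properties using (concatMap-++)
  open import Relation.Nullary using (yes; no; does; contradiction)
  open import Relation.Binary.Bundles using (Setoid)
  open import Algebra.Bundles using (CommutativeSemigroup)
  open import Relation.Binary.PropositionalEquality as ≡ using (_≡_; _≢_)
  open import Function using (_∘_)
  import Relation.Binary.Reasoning.Setoid as SetoidReasoning

  open OrderedField F hiding (_≤_; _<_)
  open Ops F
  open SetoidReasoning setoid
  private
    +-commutativeSemigroup *-commutativeSemigroup : CommutativeSemigroup c ℓ₁
    +-commutativeSemigroup = record { isCommutativeSemigroup = +-isCommutativeSemigroup }
    *-commutativeSemigroup = record { isCommutativeSemigroup = *-isCommutativeSemigroup }
  open import Algebra.Properties.CommutativeSemigroup +-commutativeSemigroup using (interchange; x∙yz≈y∙xz)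
  open import Algebra.Properties.CommutativeSemigroup *-commutativeSemigroup using () renaming (x∙yz≈y∙xz to x*yz≈y*xz)

  infix 4 _≃_
  -- _≋_ wrapped in a record, so that both sides are inferred from a proof.
  record _≃_ (u v : LC) : Set ℓ₁ where
    constructor mk≃
    field ≃⇒≋ : u ≋ v
  open _≃_ public

  ≃-refl : ∀ {u} → u ≃ u
  ≃-refl = mk≃ λ _ → refl

  ≃-sym : ∀ {u v} → u ≃ v → v ≃ u
  ≃-sym (mk≃ e) = mk≃ (sym ∘ e)

  ≃-trans : ∀ {u v w} → u ≃ v → v ≃ w → u ≃ w
  ≃-trans (mk≃ e) (mk≃ f) = mk≃ λ b → trans (e b) (f b)

  ≃-setoid : Setoid c ℓ₁
  ≃-setoid = record { Carrier = LC ; _≈_ = _≃_ ; isEquivalence = record { refl = ≃-refl ; sym = ≃-sym ; trans = ≃-trans } }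

  module ≃-Reasoning = SetoidReasoning ≃-setoid

  ≡⇒≃ : ∀ {u v} → u ≡ v → u ≃ v
  ≡⇒≃ ≡.refl = ≃-refl

  ≡⇒coeff≈ : ∀ {u v} → u ≡ v → ∀ b → coeff u b ≈ coeff v b
  ≡⇒coeff≈ ≡.refl b = refl

  coeff-here : ∀ k {b' b} u → b' ≡ b → coeff ((k , b') ∷ u) b ≈ k + coeff u b
  coeff-here k {b'} {b} u b'≡b with b' ≟ₗ b
  ... | yes _     = refl
  ... | no b'≢b   = contradiction b'≡b b'≢b

  coeff-there : ∀ k {b' b} u → b' ≢ b → coeff ((k , b') ∷ u) b ≈ coeff u b
  coeff-there k {b'} {b} u b'≢b with b' ≟ₗ b
  ... | yes b'≡b = contradiction b'≡b b'≢b
  ... | no _     = refl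

  coeff-++ : ∀ u v b → coeff (u ++ v) b ≈ coeff u b + coeff v b
  coeff-++ []             v b = sym (+-identityˡ _)
  coeff-++ ((k , b') ∷ u) v b with b' ≟ₗ b
  ... | yes _ = trans (+-congˡ (coeff-++ u v b)) (sym (+-assoc _ _ _))
  ... | no  _ = coeff-++ u v b

  coeff-scale : ∀ k u b → coeff (scale k u) b ≈ k * coeff u b
  coeff-scale k []              b = sym (zeroʳ k)
  coeff-scale k ((k' , b') ∷ u) b with b' ≟ₗ b
  ... | yes _ = trans (+-congˡ (coeff-scale k u b)) (sym (distribˡ k k' _))
  ... | no  _ = coeff-scale k u b

  ++-cong : ∀ {u u' v v'} → u ≃ u' → v ≃ v' → u ++ v ≃ u' ++ v'
  ++-cong {u} {u'} {v} {v'} (mk≃ e) (mk≃ f) = mk≃ λ b → begin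
    coeff (u ++ v) b          ≈⟨ coeff-++ u v b ⟩
    coeff u b + coeff v b     ≈⟨ +-cong (e b) (f b) ⟩
    coeff u' b + coeff v' b   ≈⟨ coeff-++ u' v' b ⟨
    coeff (u' ++ v') b        ∎

  ++-identityʳ : ∀ u → u ++ [] ≃ u
  ++-identityʳ u = mk≃ λ b → trans (coeff-++ u [] b) (+-identityʳ _)

  scale-cong : ∀ {k k' u u'} → k ≈ k' → u ≃ u' → scale k u ≃ scale k' u'
  scale-cong {k} {k'} {u} {u'} k≈k' (mk≃ e) = mk≃ λ b → begin
    coeff (scale k u) b     ≈⟨ coeff-scale k u b ⟩
    k * coeff u b           ≈⟨ *-cong k≈k' (e b) ⟩
    k' * coeff u' b         ≈⟨ coeff-scale k' u' b ⟨
    coeff (scale k' u') b   ∎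

  ∷-cong : ∀ {k k' b u v} → k ≈ k' → u ≃ v → (k , b) ∷ u ≃ (k' , b) ∷ v
  ∷-cong {k} {k'} {b'} {u} {v} k≈k' (mk≃ e) = mk≃ λ b → aux b
    where
    aux : ∀ b → coeff ((k , b') ∷ u) b ≈ coeff ((k' , b') ∷ v) b
    aux b with b' ≟ₗ b
    ... | yes _ = +-cong k≈k' (e b)
    ... | no  _ = e b

  ∷-merge : ∀ k k' b → (k , b) ∷ (k' , b) ∷ [] ≃ (k + k' , b) ∷ []
  ∷-merge k k' b' = mk≃ λ b → aux b
    where
    aux : ∀ b → coeff ((k , b') ∷ (k' , b') ∷ []) b ≈ coeff ((k + k' , b') ∷ []) b
    aux b with b' ≟ₗ b
    ... | yes _ = sym (+-assoc _ _ _)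
    ... | no  _ = refl

  Supp : ∀ {p} → (List ℕ → Set p) → LC → Set (c ⊔ p)
  Supp S = All (S ∘ proj₂)

  Supp-scale : ∀ {p} {S : List ℕ → Set p} k u → Supp S u → Supp S (scale k u)
  Supp-scale k []      []       = []
  Supp-scale k (_ ∷ u) (s ∷ ss) = s ∷ Supp-scale k u ss

  Supp-extend : ∀ {p} {S : List ℕ → Set p} f u → Supp S u → (∀ {b} → S b → Supp S (f b)) → Supp S (extend f u)
  Supp-extend f []            []       Sf = []
  Supp-extend f ((k , b) ∷ u) (s ∷ ss) Sf = ++⁺ (Supp-scale k (f b) (Sf s)) (Supp-extend f u ss Sf)

  linear : (List ℕ → Carrier) → LC → Carrier
  linear g []            = 0#
  linear g ((k , b) ∷ u) = k * g b + linear g u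

  linear-cong : ∀ {g h} u → (∀ b → g b ≈ h b) → linear g u ≈ linear h u
  linear-cong []            g≈h = refl
  linear-cong ((k , b) ∷ u) g≈h = +-cong (*-congˡ (g≈h b)) (linear-cong u g≈h)

  linear-cong-on : ∀ {p} {S : List ℕ → Set p} {g h} u → Supp S u → (∀ {b} → S b → g b ≈ h b) → linear g u ≈ linear h u
  linear-cong-on []            []       g≈h = refl
  linear-cong-on ((k , b) ∷ u) (s ∷ ss) g≈h = +-cong (*-congˡ (g≈h s)) (linear-cong-on u ss g≈h)

  linear-0 : ∀ u → linear (λ _ → 0#) u ≈ 0#
  linear-0 []            = refl
  linear-0 ((k , b) ∷ u) = trans (+-cong (zeroʳ k) (linear-0 u)) (+-identityʳ 0#)

  linear-+ : ∀ g h u → linear (λ b → g b + h b) u ≈ linear g u + linear h u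
  linear-+ g h []            = sym (+-identityʳ 0#)
  linear-+ g h ((k , b) ∷ u) = begin
    k * (g b + h b) + linear (λ b → g b + h b) u        ≈⟨ +-cong (distribˡ k _ _) (linear-+ g h u) ⟩
    (k * g b + k * h b) + (linear g u + linear h u)     ≈⟨ interchange _ _ _ _ ⟩
    (k * g b + linear g u) + (k * h b + linear h u)     ∎

  linear-* : ∀ k g u → linear (λ b → k * g b) u ≈ k * linear g u
  linear-* k g []              = sym (zeroʳ k)
  linear-* k g ((k' , b) ∷ u) = begin
    k' * (k * g b) + linear (λ b → k * g b) u    ≈⟨ +-cong (x*yz≈y*xz k' k (g b)) (linear-* k g u) ⟩
    k * (k' * g b) + k * linear g u              ≈⟨ distribˡ k _ _ ⟨
    k * (k' * g b + linear g u)                  ∎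

  linear-++ : ∀ g u v → linear g (u ++ v) ≈ linear g u + linear g v
  linear-++ g []            v = sym (+-identityˡ _)
  linear-++ g ((k , b) ∷ u) v = trans (+-congˡ (linear-++ g u v)) (sym (+-assoc _ _ _))

  linear-scale : ∀ g k u → linear g (scale k u) ≈ k * linear g u
  linear-scale g k []              = sym (zeroʳ k)
  linear-scale g k ((k' , b) ∷ u) = begin
    k * k' * g b + linear g (scale k u)   ≈⟨ +-cong (*-assoc k k' (g b)) (linear-scale g k u) ⟩
    k * (k' * g b) + k * linear g u       ≈⟨ distribˡ k _ _ ⟨
    k * (k' * g b + linear g u)           ∎

  linear-extend : ∀ g f u → linear g (extend f u) ≈ linear (linear g ∘ f) u
  linear-extend g f []            = refl
  linear-extend g f ((k , b) ∷ u) = begin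
    linear g (scale k (f b) ++ extend f u)              ≈⟨ linear-++ g (scale k (f b)) (extend f u) ⟩
    linear g (scale k (f b)) + linear g (extend f u)    ≈⟨ +-cong (linear-scale g k (f b)) (linear-extend g f u) ⟩
    k * linear g (f b) + linear (linear g ∘ f) u        ∎

  linear-comm : ∀ (G : List ℕ → List ℕ → Carrier) u v →
                linear (λ b → linear (λ a → G a b) u) v ≈ linear (λ a → linear (G a) v) u
  linear-comm G u []             = sym (linear-0 u)
  linear-comm G u ((k , b) ∷ v) = begin
    k * linear (λ a → G a b) u + linear (λ b → linear (λ a → G a b) u) v   ≈⟨ +-cong (linear-* k (λ a → G a b) u) (sym (linear-comm G u v)) ⟨
    linear (λ a → k * G a b) u + linear (λ a → linear (G a) v) u           ≈⟨ linear-+ (λ a → k * G a b) (λ a → linear (G a) v) u ⟨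
    linear (λ a → k * G a b + linear (G a) v) u                             ∎

  linear-vanish : ∀ {g} u → Supp (λ b → g b ≈ 0#) u → linear g u ≈ 0#
  linear-vanish []            []         = refl
  linear-vanish ((k , b) ∷ u) (gb≈0 ∷ s) = trans (+-cong (trans (*-congˡ gb≈0) (zeroʳ k)) (linear-vanish u s)) (+-identityʳ 0#)

  coeff-extend : ∀ f u b → coeff (extend f u) b ≈ linear (λ b' → coeff (f b') b) u
  coeff-extend f []             b = refl
  coeff-extend f ((k , b') ∷ u) b = begin
    coeff (scale k (f b') ++ extend f u) b                ≈⟨ coeff-++ (scale k (f b')) (extend f u) b ⟩
    coeff (scale k (f b')) b + coeff (extend f u) b       ≈⟨ +-cong (coeff-scale k (f b') b) (coeff-extend f u b) ⟩
    k * coeff (f b') b + linear (λ b'' → coeff (f b'') b) u ∎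

  remove : List ℕ → LC → LC
  remove b []             = []
  remove b ((k , b') ∷ u) = if does (b' ≟ₗ b) then remove b u else (k , b') ∷ remove b u

  linear-remove : ∀ g b u → linear g u ≈ coeff u b * g b + linear g (remove b u)
  linear-remove g b []             = sym (trans (+-identityʳ _) (zeroˡ _))
  linear-remove g b ((k , b') ∷ u) with b' ≟ₗ b
  ... | yes ≡.refl = begin
    k * g b + linear g u                                   ≈⟨ +-congˡ (linear-remove g b u) ⟩
    k * g b + (coeff u b * g b + linear g (remove b u))    ≈⟨ +-assoc _ _ _ ⟨
    k * g b + coeff u b * g b + linear g (remove b u)      ≈⟨ +-congʳ (distribʳ (g b) k _) ⟨
    (k + coeff u b) * g b + linear g (remove b u)          ∎
  ... | no _ = begin
    k * g b' + linear g u                                  ≈⟨ +-congˡ (linear-remove g b u) ⟩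
    k * g b' + (coeff u b * g b + linear g (remove b u))   ≈⟨ x∙yz≈y∙xz _ _ _ ⟩
    coeff u b * g b + (k * g b' + linear g (remove b u))   ∎

  coeff-remove-≡ : ∀ b u → coeff (remove b u) b ≈ 0#
  coeff-remove-≡ b []             = refl
  coeff-remove-≡ b ((k , b') ∷ u) with b' ≟ₗ b
  ... | yes _   = coeff-remove-≡ b u
  ... | no b'≢b = trans (coeff-there k (remove b u) b'≢b) (coeff-remove-≡ b u)

  coeff-remove-≢ : ∀ {b b'} u → b ≢ b' → coeff (remove b u) b' ≈ coeff u b'
  coeff-remove-≢ []             b≢b' = refl
  coeff-remove-≢ {b} {b'} ((k , b'') ∷ u) b≢b' with b'' ≟ₗ b
  ... | yes ≡.refl = trans (coeff-remove-≢ u b≢b') (sym (coeff-there k u b≢b'))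
  ... | no _ with b'' ≟ₗ b'
  ...   | yes _ = +-congˡ (coeff-remove-≢ u b≢b')
  ...   | no  _ = coeff-remove-≢ u b≢b'

  remove-cong : ∀ b {u v} → u ≃ v → remove b u ≃ remove b v
  remove-cong b {u} {v} (mk≃ e) = mk≃ λ b' → aux b'
    where
    aux : ∀ b' → coeff (remove b u) b' ≈ coeff (remove b v) b'
    aux b' with b ≟ₗ b'
    ... | yes ≡.refl = trans (coeff-remove-≡ b u) (sym (coeff-remove-≡ b v))
    ... | no b≢b'    = trans (coeff-remove-≢ u b≢b') (trans (e b') (sym (coeff-remove-≢ v b≢b')))

  length-remove : ∀ b u → length (remove b u) ℕ.≤ length u
  length-remove b []             = ℕ.z≤n
  length-remove b ((k , b') ∷ u) with b' ≟ₗ b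
  ... | yes _ = ℕ.m≤n⇒m≤1+n (length-remove b u)
  ... | no  _ = ℕ.s≤s (length-remove b u)

  length-remove-head : ∀ k b u → length (remove b ((k , b) ∷ u)) ℕ.≤ length u
  length-remove-head k b u with b ≟ₗ b
  ... | yes _   = length-remove b u
  ... | no b≢b  = contradiction ≡.refl b≢b

  -- Induction on the total length, removing one basis element from both sides at each step.
  linear-resp-≃ : ∀ g {u v} → u ≃ v → linear g u ≈ linear g v
  linear-resp-≃ g {u} {v} = go (length u ℕ.+ length v) ℕ.≤-refl
    where
    step : ∀ b {u v} → u ≃ v → linear g (remove b u) ≈ linear g (remove b v) → linear g u ≈ linear g v
    step b {u} {v} (mk≃ e) ih = begin
      linear g u                                  ≈⟨ linear-remove g b u ⟩
      coeff u b * g b + linear g (remove b u)     ≈⟨ +-cong (*-congʳ (e b)) ih ⟩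
      coeff v b * g b + linear g (remove b v)     ≈⟨ linear-remove g b v ⟨
      linear g v                                  ∎
    go : ∀ N {u v} → length u ℕ.+ length v ℕ.≤ N → u ≃ v → linear g u ≈ linear g v
    go N       {[]}           {[]}           _ _ = refl
    go (suc N) {(k , b) ∷ u}  {v}            (ℕ.s≤s len) u≃v =
      step b u≃v (go N (ℕ.≤-trans (ℕ.+-mono-≤ (length-remove-head k b u) (length-remove b v)) len) (remove-cong b u≃v))
    go (suc N) {[]}           {(k , b) ∷ v}  (ℕ.s≤s len) u≃v =
      step b u≃v (go N (ℕ.≤-trans (length-remove-head k b v) len) (remove-cong b u≃v))

  Supp-remove : ∀ {p} {S : List ℕ → Set p} b u → Supp S u → Supp S (remove b u)
  Supp-remove b []             []       = []
  Supp-remove b ((k , b') ∷ u) (s ∷ ss) with b' ≟ₗ b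
  ... | yes _ = Supp-remove b u ss
  ... | no  _ = s ∷ Supp-remove b u ss

  remove-Supp : ∀ b u → Supp (_≢ b) (remove b u)
  remove-Supp b []             = []
  remove-Supp b ((k , b') ∷ u) with b' ≟ₗ b
  ... | yes _   = remove-Supp b u
  ... | no b'≢b = b'≢b ∷ remove-Supp b u

  linear-pair : ∀ {g b b'} u → b ≢ b' → (∀ {x} → x ≢ b → x ≢ b' → g x ≈ 0#) →
                linear g u ≈ coeff u b * g b + coeff u b' * g b'
  linear-pair {g} {b} {b'} u b≢b' vanish = begin
    linear g u                                                             ≈⟨ linear-remove g b u ⟩
    coeff u b * g b + linear g (remove b u)                                ≈⟨ +-congˡ (linear-remove g b' (remove b u)) ⟩
    coeff u b * g b + (coeff (remove b u) b' * g b' + linear g (remove b' (remove b u)))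
      ≈⟨ +-congˡ (+-cong (*-congʳ (coeff-remove-≢ u b≢b')) (linear-vanish _ (All.zipWith (λ (x≢b , x≢b') → vanish x≢b x≢b')
           (Supp-remove b' (remove b u) (remove-Supp b u) , remove-Supp b' (remove b u))))) ⟩
    coeff u b * g b + (coeff u b' * g b' + 0#)                             ≈⟨ +-congˡ (+-identityʳ _) ⟩
    coeff u b * g b + coeff u b' * g b'                                    ∎

  extend-congʳ : ∀ f {u v} → u ≃ v → extend f u ≃ extend f v
  extend-congʳ f {u} {v} u≃v = mk≃ λ b → begin
    coeff (extend f u) b                   ≈⟨ coeff-extend f u b ⟩
    linear (λ b' → coeff (f b') b) u       ≈⟨ linear-resp-≃ _ u≃v ⟩
    linear (λ b' → coeff (f b') b) v       ≈⟨ coeff-extend f v b ⟨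
    coeff (extend f v) b                   ∎

  extend-congˡ : ∀ {f g} u → (∀ b → f b ≃ g b) → extend f u ≃ extend g u
  extend-congˡ {f} {g} u f≃g = mk≃ λ b → begin
    coeff (extend f u) b                   ≈⟨ coeff-extend f u b ⟩
    linear (λ b' → coeff (f b') b) u       ≈⟨ linear-cong u (λ b' → ≃⇒≋ (f≃g b') b) ⟩
    linear (λ b' → coeff (g b') b) u       ≈⟨ coeff-extend g u b ⟨
    coeff (extend g u) b                   ∎

  extend-congˡ-on : ∀ {p} {S : List ℕ → Set p} {f g} u → Supp S u → (∀ {b} → S b → f b ≃ g b) → extend f u ≃ extend g u
  extend-congˡ-on {f = f} {g} u s f≃g = mk≃ λ b → begin
    coeff (extend f u) b                   ≈⟨ coeff-extend f u b ⟩
    linear (λ b' → coeff (f b') b) u       ≈⟨ linear-cong-on u s (λ sb' → ≃⇒≋ (f≃g sb') b) ⟩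
    linear (λ b' → coeff (g b') b) u       ≈⟨ coeff-extend g u b ⟨
    coeff (extend g u) b                   ∎

  extend-extend : ∀ f g u → extend g (extend f u) ≃ extend (extend g ∘ f) u
  extend-extend f g u = mk≃ λ b → begin
    coeff (extend g (extend f u)) b                         ≈⟨ coeff-extend g (extend f u) b ⟩
    linear (λ b' → coeff (g b') b) (extend f u)             ≈⟨ linear-extend _ f u ⟩
    linear (linear (λ b' → coeff (g b') b) ∘ f) u           ≈⟨ linear-cong u (λ b'' → sym (coeff-extend g (f b'') b)) ⟩
    linear (λ b'' → coeff (extend g (f b'')) b) u           ≈⟨ coeff-extend (extend g ∘ f) u b ⟨
    coeff (extend (extend g ∘ f) u) b                       ∎

  extend-comm : ∀ (H : List ℕ → List ℕ → LC) u v →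
                extend (λ b → extend (λ a → H a b) u) v ≃ extend (λ a → extend (H a) v) u
  extend-comm H u v = mk≃ λ x → begin
    coeff (extend (λ b → extend (λ a → H a b) u) v) x                ≈⟨ coeff-extend _ v x ⟩
    linear (λ b → coeff (extend (λ a → H a b) u) x) v                ≈⟨ linear-cong v (λ b → coeff-extend (λ a → H a b) u x) ⟩
    linear (λ b → linear (λ a → coeff (H a b) x) u) v                ≈⟨ linear-comm (λ a b → coeff (H a b) x) u v ⟩
    linear (λ a → linear (λ b → coeff (H a b) x) v) u                ≈⟨ linear-cong u (λ a → coeff-extend (H a) v x) ⟨
    linear (λ a → coeff (extend (H a) v) x) u                        ≈⟨ coeff-extend _ u x ⟨
    coeff (extend (λ a → extend (H a) v) u) x                        ∎

  extend-++ : ∀ f u v → extend f (u ++ v) ≡ extend f u ++ extend f v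
  extend-++ f u v = concatMap-++ _ u v

  extend-scale : ∀ f k u → extend f (scale k u) ≃ scale k (extend f u)
  extend-scale f k u = mk≃ λ b → begin
    coeff (extend f (scale k u)) b                ≈⟨ coeff-extend f (scale k u) b ⟩
    linear (λ b' → coeff (f b') b) (scale k u)    ≈⟨ linear-scale _ k u ⟩
    k * linear (λ b' → coeff (f b') b) u          ≈⟨ *-congˡ (coeff-extend f u b) ⟨
    k * coeff (extend f u) b                      ≈⟨ coeff-scale k (extend f u) b ⟨
    coeff (scale k (extend f u)) b                ∎

  extend-single : ∀ f k b → extend f ((k , b) ∷ []) ≃ scale k (f b)
  extend-single f k b = ++-identityʳ (scale k (f b))

  extend-basis : ∀ f b → extend f (basis b) ≃ f b
  extend-basis f b = ≃-trans (extend-single f 1# b) (mk≃ λ b' → trans (coeff-scale 1# (f b) b') (*-identityˡ _))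

  extend-concat : ∀ {A : Set} f (H : A → LC) xs → extend f (concat (map H xs)) ≡ concat (map (extend f ∘ H) xs)
  extend-concat f H []       = ≡.refl
  extend-concat f H (x ∷ xs) = ≡.trans (extend-++ f (H x) _) (≡.cong (extend f (H x) ++_) (extend-concat f H xs))

  concat-cong : ∀ {A : Set} {G H : A → LC} xs → (∀ x → G x ≃ H x) → concat (map G xs) ≃ concat (map H xs)
  concat-cong []       G≃H = ≃-refl
  concat-cong (x ∷ xs) G≃H = ++-cong (G≃H x) (concat-cong xs G≃H)

  concat-cong-on : ∀ {A : Set} {P : A → Set} {G H : A → LC} xs → All P xs → (∀ {x} → P x → G x ≃ H x) →
                   concat (map G xs) ≃ concat (map H xs)
  concat-cong-on []       []       G≃H = ≃-refl
  concat-cong-on (x ∷ xs) (p ∷ ps) G≃H = ++-cong (G≃H p) (concat-cong-on xs ps G≃H)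

  extend-diagonal : ∀ (λ′ : List ℕ → Carrier) {k} u → Supp (λ b → λ′ b ≈ k) u →
                    extend (λ b → (λ′ b , b) ∷ []) u ≃ scale k u
  extend-diagonal λ′ []             []          = ≃-refl
  extend-diagonal λ′ ((k' , b) ∷ u) (λb≈k ∷ s) = ∷-cong (trans (*-comm k' (λ′ b)) (*-congʳ λb≈k)) (extend-diagonal λ′ u s)

  rename : (List ℕ → List ℕ) → LC → LC
  rename f = map (Product.map₂ f)

  rename-extend : ∀ f u → rename f u ≃ extend (basis ∘ f) u
  rename-extend f []            = ≃-refl
  rename-extend f ((k , b) ∷ u) = ∷-cong (sym (*-identityʳ k)) (rename-extend f u)

  coeff-graph-0 : ∀ (h : List ℕ → Carrier) {ρ} L → count ρ L ≡ 0 → coeff (map (λ τ → (h τ , τ)) L) ρ ≈ 0#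
  coeff-graph-0 h []      _  = refl
  coeff-graph-0 h {ρ} (τ ∷ L) c≡0 with τ ≟ₗ ρ
  ... | no  _ = coeff-graph-0 h L c≡0

  coeff-graph-1 : ∀ (h : List ℕ → Carrier) {ρ} L → count ρ L ≡ 1 → coeff (map (λ τ → (h τ , τ)) L) ρ ≈ h ρ
  coeff-graph-1 h {ρ} (τ ∷ L) c≡1 with τ ≟ₗ ρ
  ... | yes ≡.refl = trans (+-congˡ (coeff-graph-0 h L (ℕ.suc-injective c≡1))) (+-identityʳ (h τ))
  ... | no  _      = coeff-graph-1 h L c≡1

module FieldProperties {c ℓ₁ ℓ₂} (F : OrderedField c ℓ₁ ℓ₂) where
  open import Data.Nat using (zero; suc)
  open import Data.Sum using (inj₁; inj₂)
  open import Relation.Nullary using (¬_)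
  open import Relation.Binary.Structures using (IsTotalOrder)
  open import Algebra.Bundles using (CommutativeRing)
  import Relation.Binary.Reasoning.Setoid as SetoidReasoning

  open OrderedField F
  open Ops F
  open IsTotalOrder isTotalOrder using (total; antisym; ≲-respˡ-≈; ≲-respʳ-≈)
    renaming (trans to ≤-trans; reflexive to ≤-reflexive)
  open SetoidReasoning setoid
  private
    commutativeRing : CommutativeRing c ℓ₁
    commutativeRing = record { isCommutativeRing = isCommutativeRing }
  open import Algebra.Properties.Ring (CommutativeRing.ring commutativeRing) using (-1*x≈-x; -‿involutive)
  open import Algebra.Solver.Ring.NaturalCoefficients.Default (CommutativeRing.commutativeSemiring commutativeRing)

  x≤y⇒0≤y-x : ∀ {x y} → x ≤ y → 0# ≤ y - x
  x≤y⇒0≤y-x {x} x≤y = ≲-respˡ-≈ (-‿inverseʳ x) (+-mono-≤ (- x) x≤y)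

  0≤y-x⇒x≤y : ∀ {x y} → 0# ≤ y - x → x ≤ y
  0≤y-x⇒x≤y {x} {y} 0≤y-x = ≲-resp-≈₂ (+-identityˡ x) y-x+x≈y (+-mono-≤ x 0≤y-x)
    where
    ≲-resp-≈₂ : ∀ {a a' b b'} → a ≈ a' → b ≈ b' → a ≤ b → a' ≤ b'
    ≲-resp-≈₂ a≈a' b≈b' = ≲-respˡ-≈ a≈a' ∘′ ≲-respʳ-≈ b≈b'
      where open import Function using (_∘′_)
    y-x+x≈y : y - x + x ≈ y
    y-x+x≈y = trans (+-assoc y (- x) x) (trans (+-congˡ (-‿inverseˡ x)) (+-identityʳ y))

  0≤+ : ∀ {x y} → 0# ≤ x → 0# ≤ y → 0# ≤ x + y
  0≤+ {x} {y} 0≤x 0≤y = ≤-trans (≲-respʳ-≈ (sym (+-identityˡ y)) 0≤y) (+-mono-≤ y 0≤x)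

  0≤1 : 0# ≤ 1#
  0≤1 with total 0# 1#
  ... | inj₁ 0≤1 = 0≤1
  ... | inj₂ 1≤0 = ≲-respʳ-≈ (trans (-1*x≈-x (- 1#)) (-‿involutive 1#)) (*-nonneg 0≤-1 0≤-1)
    where
    0≤-1 : 0# ≤ - 1#
    0≤-1 = ≲-respʳ-≈ (+-identityˡ (- 1#)) (x≤y⇒0≤y-x 1≤0)

  1≤⇒0≤ : ∀ {x} → 1# ≤ x → 0# ≤ x
  1≤⇒0≤ = ≤-trans 0≤1

  1≤⇒≉0 : ∀ {x} → 1# ≤ x → ¬ x ≈ 0#
  1≤⇒≉0 1≤x x≈0 = 0≉1 (antisym 0≤1 (≲-respʳ-≈ x≈0 1≤x))

  1≤* : ∀ {x y} → 1# ≤ x → 1# ≤ y → 1# ≤ x * y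
  1≤* {x} {y} 1≤x 1≤y = 0≤y-x⇒x≤y (≲-respʳ-≈ identity (0≤+ (*-nonneg (x≤y⇒0≤y-x 1≤x) (1≤⇒0≤ 1≤y)) (x≤y⇒0≤y-x 1≤y)))
    where
    identity : (x - 1#) * y + (y - 1#) ≈ x * y - 1#
    identity = begin
      (x - 1#) * y + (y - 1#)          ≈⟨ solve 3 (λ x y m → (x :+ m) :* y :+ (y :+ m) := x :* y :+ (m :* y :+ y) :+ m) refl x y (- 1#) ⟩
      x * y + (- 1# * y + y) - 1#      ≈⟨ +-congʳ (+-congˡ (trans (+-congʳ (-1*x≈-x y)) (-‿inverseˡ y))) ⟩
      x * y + 0# - 1#                  ≈⟨ +-congʳ (+-identityʳ _) ⟩
      x * y - 1#                       ∎

  1≤pow : ∀ {q} → 1# ≤ q → ∀ k → 1# ≤ pow q k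
  1≤pow 1≤q zero    = ≤-reflexive refl
  1≤pow 1≤q (suc k) = 1≤* 1≤q (1≤pow 1≤q k)

  0≤qint : ∀ {q} → 1# ≤ q → ∀ k → 0# ≤ qint q k
  0≤qint 1≤q zero    = ≤-reflexive refl
  0≤qint 1≤q (suc k) = 0≤+ (0≤qint 1≤q k) (1≤⇒0≤ (1≤pow 1≤q k))

  1≤qint : ∀ {q} → 1# ≤ q → ∀ k → 1# ≤ qint q (suc k)
  1≤qint {q} 1≤q k = ≤-trans (≲-respˡ-≈ (+-identityˡ 1#) (+-mono-≤ 1# (0≤qint 1≤q k)))
                              (≲-respˡ-≈ (+-comm 1# _) (≲-respʳ-≈ (+-comm (pow q k) _) (+-mono-≤ (qint q k) (1≤pow 1≤q k))))

  ⁻¹-unique : ∀ {x y} → ¬ x ≈ 0# → x * y ≈ 1# → y ≈ x ⁻¹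
  ⁻¹-unique {x} {y} x≉0 xy≈1 = begin
    y                    ≈⟨ *-identityˡ y ⟨
    1# * y               ≈⟨ *-congʳ (trans (*-comm (x ⁻¹) x) (⁻¹-inverse x x≉0)) ⟨
    x ⁻¹ * x * y         ≈⟨ *-assoc (x ⁻¹) x y ⟩
    x ⁻¹ * (x * y)       ≈⟨ *-congˡ xy≈1 ⟩
    x ⁻¹ * 1#            ≈⟨ *-identityʳ (x ⁻¹) ⟩
    x ⁻¹                 ∎

  ≉0-* : ∀ {x y} → ¬ x ≈ 0# → ¬ y ≈ 0# → ¬ x * y ≈ 0#
  ≉0-* {x} {y} x≉0 y≉0 xy≈0 = y≉0 (begin
    y                    ≈⟨ *-identityˡ y ⟨
    1# * y               ≈⟨ *-congʳ (trans (*-comm (x ⁻¹) x) (⁻¹-inverse x x≉0)) ⟨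
    x ⁻¹ * x * y         ≈⟨ *-assoc (x ⁻¹) x y ⟩
    x ⁻¹ * (x * y)       ≈⟨ *-congˡ xy≈0 ⟩
    x ⁻¹ * 0#            ≈⟨ zeroʳ (x ⁻¹) ⟩
    0#                   ∎)

  ⁻¹-* : ∀ {x y} → ¬ x ≈ 0# → ¬ y ≈ 0# → (x * y) ⁻¹ ≈ x ⁻¹ * y ⁻¹
  ⁻¹-* {x} {y} x≉0 y≉0 = sym (⁻¹-unique (≉0-* x≉0 y≉0) (begin
    x * y * (x ⁻¹ * y ⁻¹)       ≈⟨ solve 4 (λ x y x' y' → x :* y :* (x' :* y') := x :* x' :* (y :* y')) refl x y (x ⁻¹) (y ⁻¹) ⟩
    x * x ⁻¹ * (y * y ⁻¹)       ≈⟨ *-cong (⁻¹-inverse x x≉0) (⁻¹-inverse y y≉0) ⟩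
    1# * 1#                     ≈⟨ *-identityˡ 1# ⟩
    1#                          ∎))

  x*[x*y]⁻¹≈y⁻¹ : ∀ {x y} → ¬ x ≈ 0# → ¬ y ≈ 0# → x * (x * y) ⁻¹ ≈ y ⁻¹
  x*[x*y]⁻¹≈y⁻¹ {x} {y} x≉0 y≉0 = begin
    x * (x * y) ⁻¹              ≈⟨ *-congˡ (⁻¹-* x≉0 y≉0) ⟩
    x * (x ⁻¹ * y ⁻¹)           ≈⟨ *-assoc x (x ⁻¹) (y ⁻¹) ⟨
    x * x ⁻¹ * y ⁻¹             ≈⟨ *-congʳ (⁻¹-inverse x x≉0) ⟩
    1# * y ⁻¹                   ≈⟨ *-identityˡ (y ⁻¹) ⟩
    y ⁻¹                        ∎

  [x*y]*[z*x]⁻¹≈y*z⁻¹ : ∀ {x y z} → ¬ x ≈ 0# → ¬ z ≈ 0# → (x * y) * (z * x) ⁻¹ ≈ y * z ⁻¹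
  [x*y]*[z*x]⁻¹≈y*z⁻¹ {x} {y} {z} x≉0 z≉0 = begin
    x * y * (z * x) ⁻¹          ≈⟨ *-congˡ (⁻¹-* z≉0 x≉0) ⟩
    x * y * (z ⁻¹ * x ⁻¹)       ≈⟨ solve 4 (λ x y z' x' → x :* y :* (z' :* x') := x :* x' :* (y :* z')) refl x y (z ⁻¹) (x ⁻¹) ⟩
    x * x ⁻¹ * (y * z ⁻¹)       ≈⟨ *-congʳ (⁻¹-inverse x x≉0) ⟩
    1# * (y * z ⁻¹)             ≈⟨ *-identityˡ _ ⟩
    y * z ⁻¹                    ∎

  1+[x-1]≈x : ∀ x → 1# + (x - 1#) ≈ x
  1+[x-1]≈x x = begin
    1# + (x - 1#)     ≈⟨ +-comm 1# _ ⟩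
    x - 1# + 1#       ≈⟨ +-assoc x (- 1#) 1# ⟩
    x + (- 1# + 1#)   ≈⟨ +-congˡ (-‿inverseˡ 1#) ⟩
    x + 0#            ≈⟨ +-identityʳ x ⟩
    x                 ∎

module Intertwining {c ℓ₁ ℓ₂} (F : OrderedField c ℓ₁ ℓ₂) where
  open import Data.Nat using (ℕ; zero; suc; _≤_; _<_; z≤n; s≤s)
  open import Data.Nat.Properties using (<-trans; n<1+n; ≤-trans)
  open import Data.List using (List; upTo; concat; map)
  open import Data.List.Relation.Unary.All.Properties using (applyUpTo⁺₁)
  open import Function using (_∘_)

  open OrderedField F hiding (_≤_; _<_)
  open Ops F
  open FreeModule F
  open ≃-Reasoning

  chain-cong : ∀ T k {u v} → u ≃ v → chain T k u ≃ chain T k v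
  chain-cong T zero    u≃v = u≃v
  chain-cong T (suc k) u≃v = chain-cong T k (extend-congʳ (T (suc k)) u≃v)

  tsetlin-cong : ∀ n T X {u v} → u ≃ v → tsetlin n T X u ≃ tsetlin n T X v
  tsetlin-cong n T X u≃v = concat-cong (upTo n) λ k → extend-congʳ X (chain-cong T k u≃v)

  extend-intertwine : ∀ {p} {S : List ℕ → Set p} P T T' u → Supp S u →
                      (∀ {b} → S b → extend P (T b) ≃ extend T' (P b)) → extend P (extend T u) ≃ extend T' (extend P u)
  extend-intertwine P T T' u s PT≃T'P = begin
    extend P (extend T u)            ≈⟨ extend-extend T P u ⟩
    extend (extend P ∘ T) u          ≈⟨ extend-congˡ-on u s PT≃T'P ⟩
    extend (extend T' ∘ P) u         ≈⟨ extend-extend P T' u ⟨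
    extend T' (extend P u)           ∎

  module _ (n : ℕ) (S : List ℕ → Set) (T T' : ℕ → List ℕ → LC) (X X' P : List ℕ → LC)
           (T-Supp : ∀ i {b} → S b → Supp S (T i b))
           (T-intertwine : ∀ i {b} → 1 ≤ i → i < n → S b → extend P (T i b) ≃ extend (T' i) (P b))
           (X-intertwine : ∀ {b} → 0 < n → S b → extend P (X b) ≃ extend X' (P b)) where

    chain-Supp : ∀ k u → Supp S u → Supp S (chain T k u)
    chain-Supp zero    u s = s
    chain-Supp (suc k) u s = chain-Supp k _ (Supp-extend (T (suc k)) u s (T-Supp (suc k)))

    chain-intertwine : ∀ k → k < n → ∀ u → Supp S u → extend P (chain T k u) ≃ chain T' k (extend P u)
    chain-intertwine zero    _   u s = ≃-refl
    chain-intertwine (suc k) k<n u s = begin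
      extend P (chain T k (extend (T (suc k)) u))
        ≈⟨ chain-intertwine k (<-trans (n<1+n k) k<n) _ (Supp-extend (T (suc k)) u s (T-Supp (suc k))) ⟩
      chain T' k (extend P (extend (T (suc k)) u))
        ≈⟨ chain-cong T' k (extend-intertwine P (T (suc k)) (T' (suc k)) u s (T-intertwine (suc k) (s≤s z≤n) k<n)) ⟩
      chain T' k (extend (T' (suc k)) (extend P u)) ∎

    tsetlin-intertwine : ∀ u → Supp S u → extend P (tsetlin n T X u) ≃ tsetlin n T' X' (extend P u)
    tsetlin-intertwine u s = begin
      extend P (tsetlin n T X u)
        ≡⟨ extend-concat P (λ k → extend X (chain T k u)) (upTo n) ⟩
      concat (map (λ k → extend P (extend X (chain T k u))) (upTo n))
        ≈⟨ concat-cong-on (upTo n) (applyUpTo⁺₁ (λ k → k) n (λ k<n → k<n)) step ⟩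
      tsetlin n T' X' (extend P u) ∎
      where
      step : ∀ {k} → k < n → extend P (extend X (chain T k u)) ≃ extend X' (chain T' k (extend P u))
      step {k} k<n = begin
        extend P (extend X (chain T k u))      ≈⟨ extend-intertwine P X X' _ (chain-Supp k u s) (X-intertwine (≤-trans (s≤s z≤n) k<n)) ⟩
        extend X' (extend P (chain T k u))     ≈⟨ extend-congʳ X' (chain-intertwine k k<n u s) ⟩
        extend X' (chain T' k (extend P u))    ∎

module Generators {c ℓ₁ ℓ₂} (F : OrderedField c ℓ₁ ℓ₂) where
  open Positions
  open Blocks
  open import Data.Nat as ℕ using (ℕ; zero; suc; _∸_)
  open import Data.Nat.Properties as ℕ using (<-≤-trans)
  open import Data.Product using (_,_)
  open import Data.List using (List; []; _∷_; drop)
  open import Data.Nat.ListAction using (sum)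
  open import Data.List.Relation.Unary.All using (All; []; _∷_)
  open import Relation.Nullary using (¬_; yes; no; contradiction)
  open import Relation.Binary.PropositionalEquality as ≡ using (_≡_; _≢_)
  import Relation.Binary.Reasoning.Setoid as SetoidReasoning

  open OrderedField F
  open Ops F
  open FreeModule F
  open FieldProperties F

  TS-descent : ∀ q i π → at π (suc i) ℕ.< at π i → TS q i π ≡ (q , swapAt i π) ∷ []
  TS-descent q i π p rewrite <ᵇ-< p = ≡.refl

  TS-ascent : ∀ q i π → at π i ℕ.≤ at π (suc i) → TS q i π ≡ (1# , swapAt i π) ∷ (q - 1# , π) ∷ []
  TS-ascent q i π p rewrite <ᵇ-≥ p = ≡.refl

  TW-descent : ∀ q i w → at w (suc i) ℕ.≤ at w i → TW q i w ≡ (q , swapAt i w) ∷ []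
  TW-descent q i w p rewrite ≤ᵇ-≤ p = ≡.refl

  TW-ascent : ∀ q i w → at w i ℕ.< at w (suc i) → TW q i w ≡ (1# , swapAt i w) ∷ (q - 1# , w) ∷ []
  TW-ascent q i w p rewrite ≤ᵇ-> p = ≡.refl

  TS-Supp : ∀ {S : List ℕ → Set} q i π → S π → S (swapAt i π) → Supp S (TS q i π)
  TS-Supp {S} q i π s s' with at π (suc i) ℕ.<? at π i
  ... | yes p = ≡.subst (Supp S) (≡.sym (TS-descent q i π p)) (s' ∷ [])
  ... | no ¬p = ≡.subst (Supp S) (≡.sym (TS-ascent q i π (ℕ.≮⇒≥ ¬p))) (s' ∷ s ∷ [])

  TW-Supp : ∀ {S : List ℕ → Set} q i w → S w → S (swapAt i w) → Supp S (TW q i w)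
  TW-Supp {S} q i w s s' with at w (suc i) ℕ.≤? at w i
  ... | yes p = ≡.subst (Supp S) (≡.sym (TW-descent q i w p)) (s' ∷ [])
  ... | no ¬p = ≡.subst (Supp S) (≡.sym (TW-ascent q i w (ℕ.≰⇒> ¬p))) (s' ∷ s ∷ [])

  weightS : Carrier → List ℕ → (ℕ → Carrier) → ℕ → Carrier
  weightS q m x a = x a * (pow q (sum m ∸ a)) ⁻¹

  weightW : Carrier → List ℕ → (ℕ → Carrier) → ℕ → Carrier
  weightW q m xb j = xb j * (pow q (sum (drop j m)) * qint q (at m j)) ⁻¹

  qint-≉0 : ∀ {q} → 1# ≤ q → ∀ {k} → k ≢ 0 → ¬ qint q k ≈ 0#
  qint-≉0 1≤q {zero}  k≢0 = contradiction ≡.refl k≢0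
  qint-≉0 1≤q {suc k} _   = 1≤⇒≉0 (1≤qint 1≤q k)

  -- This is where m-compatibility and x̄_j = [m_j]_q x_{n_j} enter.
  weight-compatible : ∀ {q m x} → 1# ≤ q → All (_≢ 0) m → Compatible q m x →
                      ∀ {a} → 1 ℕ.≤ a → a ℕ.≤ sum m → weightS q m x a ≈ weightW q m (xbar q m x) (blk m a)
  weight-compatible {q} {m} {x} 1≤q m≢0 compat {a} 1≤a a≤n = begin
    x a * (pow q (sum m ∸ a)) ⁻¹                       ≈⟨ compat j a (nPart m j) 1≤j j≤ℓ lower upper (<-≤-trans lower upper) ℕ.≤-refl ⟩
    x nⱼ * (pow q (sum m ∸ nⱼ)) ⁻¹                      ≡⟨ ≡.cong (λ e → x nⱼ * (pow q e) ⁻¹) (sum-drop m j) ⟨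
    x nⱼ * (pow q (sum (drop j m))) ⁻¹                  ≈⟨ [x*y]*[z*x]⁻¹≈y*z⁻¹ (qint-≉0 1≤q (at-All m≢0 1≤j j≤ℓ)) (1≤⇒≉0 (1≤pow 1≤q (sum (drop j m)))) ⟨
    xbar q m x j * (pow q (sum (drop j m)) * qint q (at m j)) ⁻¹ ∎
    where
    open SetoidReasoning setoid
    j  = blk m a
    nⱼ = nPart m j
    open InBlock (blk-InBlock m 1≤a a≤n)

module Projection {c ℓ₁ ℓ₂} (F : OrderedField c ℓ₁ ℓ₂) where
  open Positions
  open Blocks
  open Young using (∈-oneTo⁻; length-oneTo)
  open import Data.Nat as ℕ using (ℕ; suc; _≤_; _<_; s≤s; z≤n)
  open import Data.Nat.Properties as ℕ using (≤-antisym; ≮⇒≥; ≰⇒>)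
  open import Data.List using (List; []; _∷_; length)
  open import Data.Nat.ListAction using (sum)
  open import Data.List.Relation.Unary.All using (All; []; _∷_)
  open import Data.List.Relation.Unary.Any using (here)
  open import Data.List.Relation.Binary.Permutation.Propositional using (_↭_; ↭-trans)
  open import Data.List.Relation.Binary.Permutation.Propositional.Properties using (∈-resp-↭; ↭-length)
  open import Relation.Nullary using (yes; no; contradiction)
  open import Data.Product using (_,_; proj₁; proj₂)
  open import Relation.Binary.PropositionalEquality as ≡ using (_≡_; _≢_)
  open import Function using (_∘_)

  open OrderedField F hiding (_≤_; _<_)
  open OrderedField F using () renaming (_≤_ to _≤ᶠ_)
  open Ops F
  open FreeModule F
  open FieldProperties F
  open Intertwining F
  open Generators F
  open ≃-Reasoning

  module _ (q : Carrier) (m : List ℕ) {i : ℕ} {π : List ℕ} (1≤i : 1 ≤ i) (i+1≤len : suc i ≤ length π) where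
    private
      w = destd m π

      wᵢ : at w i ≡ blk m (at π i)
      wᵢ = at-map (blk m) π 1≤i (ℕ.<⇒≤ i+1≤len)

      wᵢ₊₁ : at w (suc i) ≡ blk m (at π (suc i))
      wᵢ₊₁ = at-map (blk m) π (s≤s z≤n) i+1≤len

      destd-swapAt : destd m (swapAt i π) ≡ swapAt i w
      destd-swapAt = ≡.sym (swapAt-map (blk m) i π)

    -- destd_m is weakly increasing, so a descent of π is a weak descent of destd_m π.
    rename-destd-TS : rename (destd m) (TS q i π) ≃ TW q i w
    rename-destd-TS with at π (suc i) ℕ.<? at π i
    ... | yes descent = begin
      rename (destd m) (TS q i π)      ≡⟨ ≡.cong (rename (destd m)) (TS-descent q i π descent) ⟩
      (q , destd m (swapAt i π)) ∷ []  ≡⟨ ≡.cong (λ v → (q , v) ∷ []) destd-swapAt ⟩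
      (q , swapAt i w) ∷ []            ≡⟨ TW-descent q i w (≡.subst₂ _≤_ (≡.sym wᵢ₊₁) (≡.sym wᵢ) (blk-mono m (ℕ.<⇒≤ descent))) ⟨
      TW q i w                         ∎
    ... | no ¬descent with at w (suc i) ℕ.≤? at w i
    ...   | no ¬weak-descent = begin
      rename (destd m) (TS q i π)                          ≡⟨ ≡.cong (rename (destd m)) (TS-ascent q i π (≮⇒≥ ¬descent)) ⟩
      (1# , destd m (swapAt i π)) ∷ (q - 1# , w) ∷ []      ≡⟨ ≡.cong (λ v → (1# , v) ∷ (q - 1# , w) ∷ []) destd-swapAt ⟩
      (1# , swapAt i w) ∷ (q - 1# , w) ∷ []                ≡⟨ TW-ascent q i w (≰⇒> ¬weak-descent) ⟨
      TW q i w                                             ∎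
    ...   | yes weak-descent = begin
      rename (destd m) (TS q i π)                          ≡⟨ ≡.cong (rename (destd m)) (TS-ascent q i π (≮⇒≥ ¬descent)) ⟩
      (1# , destd m (swapAt i π)) ∷ (q - 1# , w) ∷ []      ≡⟨ ≡.cong (λ v → (1# , v) ∷ (q - 1# , w) ∷ []) (≡.trans destd-swapAt w-fixed) ⟩
      (1# , w) ∷ (q - 1# , w) ∷ []                         ≈⟨ ∷-merge 1# (q - 1#) w ⟩
      (1# + (q - 1#) , w) ∷ []                             ≈⟨ ∷-cong (1+[x-1]≈x q) ≃-refl ⟩
      (q , w) ∷ []                                         ≡⟨ ≡.cong (λ v → (q , v) ∷ []) w-fixed ⟨
      (q , swapAt i w) ∷ []                                ≡⟨ TW-descent q i w weak-descent ⟨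
      TW q i w                                             ∎
      where
      w-fixed : swapAt i w ≡ w
      w-fixed = swapAt-fixed i w (≡.trans wᵢ (≡.trans (≤-antisym (blk-mono m (≮⇒≥ ¬descent))
                  (≡.subst₂ _≤_ wᵢ₊₁ wᵢ weak-descent)) (≡.sym wᵢ₊₁)))

  module _ {q : Carrier} {m : List ℕ} {x : ℕ → Carrier} (1≤q : 1# ≤ᶠ q) (m≢0 : All (_≢ 0) m)
           (compat : Compatible q m x) where
    private
      n = sum m
      P : List ℕ → LC
      P = basis ∘ destd m

    proj-TS : ∀ i {π} → 1 ≤ i → i < n → π ↭ oneTo n → extend P (TS q i π) ≃ extend (TW q i) (P π)
    proj-TS i {π} 1≤i i<n π↭ = begin
      extend P (TS q i π)             ≈⟨ rename-extend (destd m) (TS q i π) ⟨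
      rename (destd m) (TS q i π)     ≈⟨ rename-destd-TS q m 1≤i (≡.subst (suc i ≤_) (≡.sym length-π) i<n) ⟩
      TW q i (destd m π)              ≈⟨ extend-basis (TW q i) (destd m π) ⟨
      extend (TW q i) (P π)           ∎
      where length-π = ≡.trans (↭-length π↭) (length-oneTo n)

    proj-X : ∀ {π} → 0 < n → π ↭ oneTo n → extend P (XS q m x π) ≃ extend (XW q m (xbar q m x)) (P π)
    proj-X {[]}    0<n π↭ = contradiction (≡.trans (↭-length π↭) (length-oneTo n)) (ℕ.<⇒≢ 0<n)
    proj-X {a ∷ π} 0<n π↭ = begin
      extend P (XS q m x (a ∷ π))                        ≈⟨ extend-single P _ (a ∷ π) ⟩
      scale (weightS q m x a) (basis (destd m (a ∷ π)))  ≈⟨ ∷-cong (trans (*-identityʳ _) (weight-compatible 1≤q m≢0 compat 1≤a a≤n)) ≃-refl ⟩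
      XW q m (xbar q m x) (destd m (a ∷ π))              ≈⟨ extend-basis (XW q m (xbar q m x)) (destd m (a ∷ π)) ⟨
      extend (XW q m (xbar q m x)) (P (a ∷ π))           ∎
      where
      1≤a×a≤n = ∈-oneTo⁻ (∈-resp-↭ π↭ (here ≡.refl))
      1≤a = proj₁ 1≤a×a≤n
      a≤n = proj₂ 1≤a×a≤n

    proj-intertwines : ∀ π → π ↭ oneTo n → proj m (TSn q m x (basis π)) ≋ TWm q m (xbar q m x) (proj m (basis π))
    proj-intertwines π π↭ = ≃⇒≋ (begin
      proj m (TSn q m x (basis π))                 ≈⟨ rename-extend (destd m) _ ⟩
      extend P (TSn q m x (basis π))               ≈⟨ tsetlin-intertwine n (_↭ oneTo n) (TS q) (TW q) (XS q m x) (XW q m (xbar q m x)) P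
                                                        (λ i {π} π↭ → TS-Supp q i π π↭ (↭-trans (swapAt-↭ i π) π↭))
                                                        (λ i 1≤i i<n → proj-TS i 1≤i i<n) proj-X (basis π) (π↭ ∷ []) ⟩
      TWm q m (xbar q m x) (extend P (basis π))    ≈⟨ tsetlin-cong n (TW q) (XW q m (xbar q m x)) (rename-extend (destd m) (basis π)) ⟨
      TWm q m (xbar q m x) (proj m (basis π))      ∎)

module Symmetrizer {c ℓ₁ ℓ₂} (F : OrderedField c ℓ₁ ℓ₂) where
  open Positions
  open Enumeration using (count)
  open Young
  open Inversions using (invm-swapAt)
  open import Data.Nat as ℕ using (ℕ; suc; _≤_; _<_)
  import Data.Nat.Properties as ℕ
  open import Data.List using (List; []; _∷_; map; length)
  open import Data.Nat.ListAction using (sum)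
  open import Data.List.Relation.Unary.All as All using ([]; _∷_)
  open import Data.List.Relation.Unary.All.Properties using (map⁺)
  open import Data.List.Relation.Binary.Permutation.Propositional.Properties using (↭-length)
  open import Data.Product using (_,_)
  open import Data.Sum using (inj₁; inj₂)
  open import Relation.Nullary using (yes; no; contradiction)
  open import Relation.Binary.PropositionalEquality as ≡ using (_≡_; _≢_)
  open import Relation.Binary.Definitions using (tri<; tri≈; tri>)
  open import Function using (_∘_)
  import Relation.Binary.Reasoning.Setoid as SetoidReasoning

  open OrderedField F hiding (_≤_; _<_)
  open OrderedField F using () renaming (_≤_ to _≤ᶠ_)
  open Ops F
  open FreeModule F
  open FieldProperties F
  open Generators F
  open SetoidReasoning setoid

  cinv : Carrier → List ℕ → List ℕ → Carrier
  cinv q m τ = (pow q (invm m τ)) ⁻¹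

  symmetrizer : Carrier → List ℕ → LC
  symmetrizer q m = map (λ τ → (cinv q m τ , τ)) (Sm m)

  symmetrizer-Supp : ∀ q m → Supp (BlockPerm m) (symmetrizer q m)
  symmetrizer-Supp q m = map⁺ (Sm-BlockPerm m)

  coeff-single-≡ : ∀ k {b b'} → b ≡ b' → coeff ((k , b) ∷ []) b' ≈ k
  coeff-single-≡ k b≡b' = trans (coeff-here k [] b≡b') (+-identityʳ k)

  coeff-single-≢ : ∀ k {b b'} → b ≢ b' → coeff ((k , b) ∷ []) b' ≈ 0#
  coeff-single-≢ k b≢b' = coeff-there k [] b≢b'

  module _ {q : Carrier} {m : List ℕ} {a : ℕ} (1≤q : 1# ≤ᶠ q) (s : SameBlock m a) where
    open SameBlock s
    private
      E = symmetrizer q m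
      n = sum m
      q≉0 = 1≤⇒≉0 1≤q
      pow≉0 = λ k → 1≤⇒≉0 (1≤pow 1≤q k)

    coeff-TS-outside : ∀ {ρ τ} → τ ≢ ρ → τ ≢ swapAt a ρ → coeff (TS q a τ) ρ ≈ 0#
    coeff-TS-outside {ρ} {τ} τ≢ρ τ≢ρ' with at τ (suc a) ℕ.<? at τ a
    ... | yes descent = trans (≡⇒coeff≈ (TS-descent q a τ descent) ρ) (coeff-single-≢ q τ'≢ρ)
      where τ'≢ρ = τ≢ρ' ∘ swapAt-≡-swap a
    ... | no ¬descent = trans (≡⇒coeff≈ (TS-ascent q a τ (ℕ.≮⇒≥ ¬descent)) ρ)
                          (trans (coeff-there 1# ((q - 1# , τ) ∷ []) τ'≢ρ) (coeff-single-≢ (q - 1#) τ≢ρ))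
      where τ'≢ρ = τ≢ρ' ∘ swapAt-≡-swap a

    module _ {ρ} (bp : BlockPerm m ρ) (count-ρ : count ρ (Sm m) ≡ 1) (count-ρ' : count (swapAt a ρ) (Sm m) ≡ 1) where
      private
        ρ' = swapAt a ρ
        g = λ τ → coeff (TS q a τ) ρ
        len : suc a ≤ length ρ
        len = ≡.subst (suc a ≤_) (≡.sym (BlockPerm.length≡ bp)) a+1≤n
        ρ'ₐ   = at-swapAt-left ρ 1≤a len
        ρ'ₐ₊₁ = at-swapAt-right ρ 1≤a len
        ρₐ≢ρₐ₊₁ = Unique⇒at-≢ (rearrangement-unique (BlockPerm.perm bp)) 1≤a len
        ρ'≢ρ : ρ' ≢ ρ
        ρ'≢ρ ρ'≡ρ = ρₐ≢ρₐ₊₁ (≡.trans (≡.cong (λ τ → at τ a) (≡.sym ρ'≡ρ)) ρ'ₐ)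

      pair-ascent : at ρ a < at ρ (suc a) → cinv q m ρ * g ρ + cinv q m ρ' * g ρ' ≈ q * cinv q m ρ
      pair-ascent ascent = begin
        κ * g ρ + cinv q m ρ' * g ρ'                   ≈⟨ +-cong (*-congˡ gρ≈q-1) (*-congˡ gρ'≈q) ⟩
        κ * (q - 1#) + (pow q (invm m ρ')) ⁻¹ * q       ≡⟨ ≡.cong (λ k → κ * (q - 1#) + (pow q k) ⁻¹ * q) (invm-swapAt s len ascent) ⟩
        κ * (q - 1#) + (q * p) ⁻¹ * q                   ≈⟨ +-congˡ (trans (*-comm _ q) (x*[x*y]⁻¹≈y⁻¹ q≉0 (pow≉0 (invm m ρ)))) ⟩
        κ * (q - 1#) + κ                                ≈⟨ +-congˡ (*-identityʳ κ) ⟨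
        κ * (q - 1#) + κ * 1#                           ≈⟨ distribˡ κ (q - 1#) 1# ⟨
        κ * (q - 1# + 1#)                               ≈⟨ *-congˡ (trans (+-comm _ 1#) (1+[x-1]≈x q)) ⟩
        κ * q                                           ≈⟨ *-comm κ q ⟩
        q * κ                                           ∎
        where
        p = pow q (invm m ρ)
        κ = p ⁻¹
        gρ≈q-1 : g ρ ≈ q - 1#
        gρ≈q-1 = trans (≡⇒coeff≈ (TS-ascent q a ρ (ℕ.<⇒≤ ascent)) ρ)
                   (trans (coeff-there 1# ((q - 1# , ρ) ∷ []) ρ'≢ρ) (coeff-single-≡ (q - 1#) {ρ} ≡.refl))
        gρ'≈q : g ρ' ≈ q
        gρ'≈q = trans (≡⇒coeff≈ (TS-descent q a ρ' (≡.subst₂ _<_ (≡.sym ρ'ₐ₊₁) (≡.sym ρ'ₐ) ascent)) ρ)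
                  (coeff-single-≡ q (swapAt-involutive a ρ))

      pair-descent : at ρ (suc a) < at ρ a → cinv q m ρ * g ρ + cinv q m ρ' * g ρ' ≈ q * cinv q m ρ
      pair-descent descent = begin
        cinv q m ρ * g ρ + κ' * g ρ'                   ≈⟨ +-cong (*-congˡ gρ≈0) (*-congˡ gρ'≈1) ⟩
        cinv q m ρ * 0# + κ' * 1#                      ≈⟨ +-cong (zeroʳ _) (*-identityʳ κ') ⟩
        0# + κ'                                        ≈⟨ +-identityˡ κ' ⟩
        p' ⁻¹                                          ≈⟨ x*[x*y]⁻¹≈y⁻¹ q≉0 (pow≉0 (invm m ρ')) ⟨
        q * (q * p') ⁻¹                                ≡⟨ ≡.cong (λ k → q * (pow q k) ⁻¹) invm-ρ ⟨
        q * cinv q m ρ                                 ∎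
        where
        p' = pow q (invm m ρ')
        κ' = p' ⁻¹
        len' = ≡.subst (suc a ≤_) (≡.sym (↭-length (swapAt-↭ a ρ))) len
        invm-ρ : invm m ρ ≡ suc (invm m ρ')
        invm-ρ = ≡.trans (≡.cong (invm m) (≡.sym (swapAt-involutive a ρ)))
                   (invm-swapAt s len' (≡.subst₂ _<_ (≡.sym ρ'ₐ) (≡.sym ρ'ₐ₊₁) descent))
        gρ≈0 : g ρ ≈ 0#
        gρ≈0 = trans (≡⇒coeff≈ (TS-descent q a ρ descent) ρ) (coeff-single-≢ q ρ'≢ρ)
        gρ'≈1 : g ρ' ≈ 1#
        gρ'≈1 = trans (≡⇒coeff≈ (TS-ascent q a ρ' (≡.subst₂ _≤_ (≡.sym ρ'ₐ) (≡.sym ρ'ₐ₊₁) (ℕ.<⇒≤ descent))) ρ)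
                  (trans (coeff-here 1# ((q - 1# , ρ') ∷ []) (swapAt-involutive a ρ))
                    (trans (+-congˡ (coeff-single-≢ (q - 1#) ρ'≢ρ)) (+-identityʳ 1#)))

      -- Only ρ and ρ s_a contribute to the coefficient of ρ in E T_a, and their inversion numbers differ by one.
      linear-TS-symmetrizer : linear g E ≈ q * cinv q m ρ
      linear-TS-symmetrizer = begin
        linear g E                                    ≈⟨ linear-pair E (ρ'≢ρ ∘ ≡.sym) (λ {τ} → coeff-TS-outside {ρ} {τ}) ⟩
        coeff E ρ * g ρ + coeff E ρ' * g ρ'           ≈⟨ +-cong (*-congʳ (coeff-graph-1 (cinv q m) (Sm m) count-ρ))
                                                                (*-congʳ (coeff-graph-1 (cinv q m) (Sm m) count-ρ')) ⟩
        cinv q m ρ * g ρ + cinv q m ρ' * g ρ'          ≈⟨ by-order (ℕ.<-cmp (at ρ a) (at ρ (suc a))) ⟩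
        q * cinv q m ρ                                 ∎
        where
        by-order : _ → cinv q m ρ * g ρ + cinv q m ρ' * g ρ' ≈ q * cinv q m ρ
        by-order (tri≈ _ ρₐ≡ρₐ₊₁ _) = contradiction ρₐ≡ρₐ₊₁ ρₐ≢ρₐ₊₁
        by-order (tri< ascent _ _)  = pair-ascent ascent
        by-order (tri> _ _ descent) = pair-descent descent

    symmetrizer-TS : extend (TS q a) E ≃ scale q E
    symmetrizer-TS = mk≃ λ ρ → begin
      coeff (extend (TS q a) E) ρ                ≈⟨ coeff-extend (TS q a) E ρ ⟩
      linear (λ τ → coeff (TS q a τ) ρ) E        ≈⟨ by-membership ρ (count-Sm m ρ) ⟩
      q * coeff E ρ                              ≈⟨ coeff-scale q E ρ ⟨
      coeff (scale q E) ρ                        ∎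
      where
      by-membership : ∀ ρ → _ → linear (λ τ → coeff (TS q a τ) ρ) E ≈ q * coeff E ρ
      by-membership ρ (inj₁ (bp , count-ρ)) with count-Sm m (swapAt a ρ)
      ... | inj₁ (_ , count-ρ') = trans (linear-TS-symmetrizer bp count-ρ count-ρ')
                                        (*-congˡ (sym (coeff-graph-1 (cinv q m) (Sm m) count-ρ)))
      ... | inj₂ (¬bp' , _)     = contradiction (BlockPerm-swapAt s bp) ¬bp'
      by-membership ρ (inj₂ (¬bp , count-ρ)) = begin
        linear (λ τ → coeff (TS q a τ) ρ) E    ≈⟨ linear-vanish E (All.map vanish (symmetrizer-Supp q m)) ⟩
        0#                                     ≈⟨ zeroʳ q ⟨
        q * 0#                                 ≈⟨ *-congˡ (coeff-graph-0 (cinv q m) (Sm m) count-ρ) ⟨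
        q * coeff E ρ                          ∎
        where
        vanish : ∀ {τ} → BlockPerm m τ → coeff (TS q a τ) ρ ≈ 0#
        vanish {τ} bp = coeff-TS-outside {ρ} {τ} (λ { ≡.refl → ¬bp bp }) (λ { ≡.refl → ¬BlockPerm-swapAt s ¬bp bp })

module Inclusion {c ℓ₁ ℓ₂} (F : OrderedField c ℓ₁ ℓ₂) where
  open Positions
  open Blocks
  open Young
  open Standardization
  open import Data.Nat as ℕ using (ℕ; suc; _≤_; _<_; z≤n; s≤s)
  import Data.Nat.Properties as ℕ
  open import Data.List using (List; []; _∷_; map; length)
  open import Data.List.Properties using (map-∘)
  open import Data.Nat.ListAction using (sum)
  open import Data.List.Relation.Unary.All as All using (All; []; _∷_)
  open import Data.List.Relation.Unary.All.Properties using (map⁺)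
  open import Data.List.Relation.Binary.Permutation.Propositional using (_↭_; ↭-trans)
  open import Data.List.Relation.Binary.Permutation.Propositional.Properties using (↭-length)
  open import Data.Product using (_,_; proj₁; proj₂)
  open import Relation.Nullary using (yes; no; contradiction)
  open import Relation.Binary.Definitions using (tri<; tri≈; tri>)
  open import Relation.Binary.PropositionalEquality as ≡ using (_≡_; _≢_)
  open import Function using (_∘_)

  open OrderedField F hiding (_≤_; _<_)
  open OrderedField F using () renaming (_≤_ to _≤ᶠ_)
  open Ops F
  open FreeModule F
  open Intertwining F
  open Generators F
  open Symmetrizer F

  inclBasis : Carrier → List ℕ → List ℕ → LC
  inclBasis q m w = map (λ τ → (cinv q m τ , compose τ (std m w))) (Sm m)

  rightMul : List ℕ → List ℕ → LC
  rightMul σ τ = basis (compose τ σ)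

  inclBasis≃ : ∀ q m w → inclBasis q m w ≃ extend (rightMul (std m w)) (symmetrizer q m)
  inclBasis≃ q m w = begin
    inclBasis q m w                                            ≡⟨ map-∘ (Sm m) ⟩
    rename (λ τ → compose τ (std m w)) (symmetrizer q m)       ≈⟨ rename-extend _ (symmetrizer q m) ⟩
    extend (rightMul (std m w)) (symmetrizer q m)              ∎
    where open ≃-Reasoning

  module _ {q : Carrier} {m : List ℕ} {x : ℕ → Carrier} (1≤q : 1# ≤ᶠ q) (m≢0 : All (_≢ 0) m)
           (compat : Compatible q m x) where
    private
      n = sum m
      E = symmetrizer q m
      I = inclBasis q m

    module _ {w} (w↭ : w ↭ baseWord m) where
      private
        σ = std m w
        length-w : length w ≡ n
        length-w = ≡.trans (↭-length w↭) (length-baseWord m)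
        ≤n⇒≤length : ∀ {p} → p ≤ n → p ≤ length w
        ≤n⇒≤length = ≡.subst (_ ≤_) (≡.sym length-w)
        slot-at : ∀ {p} → 1 ≤ p → p ≤ n → SlotFrom m (λ _ → 0) (at w p) (at σ p)
        slot-at 1≤p p≤n = std-slot w↭ 1≤p (≤n⇒≤length p≤n)

      at-compose : ∀ τ {p} → 1 ≤ p → p ≤ n → at (compose τ σ) p ≡ at τ (at σ p)
      at-compose τ 1≤p p≤n = at-map _ σ 1≤p (≡.subst (_ ≤_) (≡.sym (length-std m w)) (≤n⇒≤length p≤n))

      swapAt-compose-std : ∀ τ {i} → at w i ≢ at w (suc i) → swapAt i (compose τ σ) ≡ compose τ (std m (swapAt i w))
      swapAt-compose-std τ {i} wᵢ≢wᵢ₊₁ = ≡.trans (swapAt-map (at τ) i σ) (≡.cong (compose τ) (≡.sym (stdAux-swapAt m i w _ wᵢ≢wᵢ₊₁)))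

      blk-compose : ∀ {τ} → BlockPerm m τ → ∀ {p} → 1 ≤ p → p ≤ n → blk m (at (compose τ σ) p) ≡ at w p
      blk-compose {τ} bp 1≤p p≤n = ≡.trans (≡.cong (blk m) (at-compose τ 1≤p p≤n))
        (≡.trans (BlockPerm.preserves bp (SlotFrom.1≤u s) (SlotFrom.u≤n s)) (SlotFrom.blk≡ s))
        where s = slot-at 1≤p p≤n

      compose-<-mono : ∀ {τ} → BlockPerm m τ → ∀ {p p'} → 1 ≤ p → p ≤ n → 1 ≤ p' → p' ≤ n →
                       at w p < at w p' → at (compose τ σ) p < at (compose τ σ) p'
      compose-<-mono bp 1≤p p≤n 1≤p' p'≤n wₚ<wₚ' = ℕ.≰⇒> λ le → ℕ.<⇒≱ wₚ<wₚ'
        (≡.subst₂ _≤_ (blk-compose bp 1≤p' p'≤n) (blk-compose bp 1≤p p≤n) (blk-mono m le))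

      TS-compose-distinct : ∀ {τ} → BlockPerm m τ → ∀ {i} → 1 ≤ i → i < n → at w i ≢ at w (suc i) →
                            TS q i (compose τ σ) ≡ rename (λ v → compose τ (std m v)) (TW q i w)
      TS-compose-distinct {τ} bp {i} 1≤i i<n wᵢ≢wᵢ₊₁ with ℕ.<-cmp (at w i) (at w (suc i))
      ... | tri≈ _ wᵢ≡wᵢ₊₁ _ = contradiction wᵢ≡wᵢ₊₁ wᵢ≢wᵢ₊₁
      ... | tri< ascent _ _ = begin
        TS q i (compose τ σ)
          ≡⟨ TS-ascent q i _ (ℕ.<⇒≤ (compose-<-mono bp 1≤i (ℕ.<⇒≤ i<n) (s≤s z≤n) i<n ascent)) ⟩
        (1# , swapAt i (compose τ σ)) ∷ (q - 1# , compose τ σ) ∷ []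
          ≡⟨ ≡.cong (λ v → (1# , v) ∷ (q - 1# , compose τ σ) ∷ []) swap≡ ⟩
        rename (λ v → compose τ (std m v)) ((1# , swapAt i w) ∷ (q - 1# , w) ∷ [])
          ≡⟨ ≡.cong (rename _) (TW-ascent q i w ascent) ⟨
        rename (λ v → compose τ (std m v)) (TW q i w) ∎
        where
        open ≡.≡-Reasoning
        swap≡ = swapAt-compose-std τ wᵢ≢wᵢ₊₁
      ... | tri> _ _ descent = begin
        TS q i (compose τ σ)
          ≡⟨ TS-descent q i _ (compose-<-mono bp (s≤s z≤n) i<n 1≤i (ℕ.<⇒≤ i<n) descent) ⟩
        (q , swapAt i (compose τ σ)) ∷ []
          ≡⟨ ≡.cong (λ v → (q , v) ∷ []) swap≡ ⟩
        rename (λ v → compose τ (std m v)) ((q , swapAt i w) ∷ [])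
          ≡⟨ ≡.cong (rename _) (TW-descent q i w (ℕ.<⇒≤ descent)) ⟨
        rename (λ v → compose τ (std m v)) (TW q i w) ∎
        where
        open ≡.≡-Reasoning
        swap≡ = swapAt-compose-std τ wᵢ≢wᵢ₊₁

      -- Equal letters w_i = w_{i+1} receive consecutive values a, a + 1 of one block in std(w).
      module Consecutive {i} (1≤i : 1 ≤ i) (i<n : i < n) (wᵢ≡wᵢ₊₁ : at w i ≡ at w (suc i)) where
        a = at σ i

        σᵢ₊₁ : at σ (suc i) ≡ suc a
        σᵢ₊₁ = stdAux-consecutive m i w _ 1≤i (≤n⇒≤length i<n) wᵢ≡wᵢ₊₁

        sameBlock : SameBlock m a
        sameBlock = record
          { 1≤a   = SlotFrom.1≤u sᵢ
          ; a+1≤n = ≡.subst (_≤ n) σᵢ₊₁ (SlotFrom.u≤n sᵢ₊₁)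
          ; blk≡  = ≡.trans (SlotFrom.blk≡ sᵢ) (≡.trans wᵢ≡wᵢ₊₁ (≡.trans (≡.sym (SlotFrom.blk≡ sᵢ₊₁)) (≡.cong (blk m) σᵢ₊₁)))
          }
          where
          sᵢ   = slot-at 1≤i (ℕ.<⇒≤ i<n)
          sᵢ₊₁ = slot-at (s≤s z≤n) i<n
        open SameBlock sameBlock

        module _ {τ} (bp : BlockPerm m τ) where
          private
            τσᵢ   = at-compose τ 1≤i (ℕ.<⇒≤ i<n)
            τσᵢ₊₁ = ≡.trans (at-compose τ (s≤s z≤n) i<n) (≡.cong (at τ) σᵢ₊₁)
            swap≡ : swapAt i (compose τ σ) ≡ compose (swapAt a τ) σ
            swap≡ = swapAt-compose i τ σ (std-unique w↭) 1≤i (≡.subst (suc i ≤_) (≡.sym (length-std m w)) (≤n⇒≤length i<n))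
                      ≡.refl σᵢ₊₁ 1≤a (≡.subst (suc a ≤_) (≡.sym (BlockPerm.length≡ bp)) a+1≤n)

          TS-compose-consecutive : TS q i (compose τ σ) ≡ rename (λ τ' → compose τ' σ) (TS q a τ)
          TS-compose-consecutive with at τ (suc a) ℕ.<? at τ a
          ... | yes descent = begin
            TS q i (compose τ σ)                    ≡⟨ TS-descent q i _ (≡.subst₂ _<_ (≡.sym τσᵢ₊₁) (≡.sym τσᵢ) descent) ⟩
            (q , swapAt i (compose τ σ)) ∷ []       ≡⟨ ≡.cong (λ v → (q , v) ∷ []) swap≡ ⟩
            (q , compose (swapAt a τ) σ) ∷ []       ≡⟨ ≡.cong (rename _) (TS-descent q a τ descent) ⟨
            rename (λ τ' → compose τ' σ) (TS q a τ) ∎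
            where open ≡.≡-Reasoning
          ... | no ¬descent = begin
            TS q i (compose τ σ)                    ≡⟨ TS-ascent q i _ (≡.subst₂ _≤_ (≡.sym τσᵢ) (≡.sym τσᵢ₊₁) (ℕ.≮⇒≥ ¬descent)) ⟩
            (1# , swapAt i (compose τ σ)) ∷ (q - 1# , compose τ σ) ∷ []
                                                    ≡⟨ ≡.cong (λ v → (1# , v) ∷ (q - 1# , compose τ σ) ∷ []) swap≡ ⟩
            (1# , compose (swapAt a τ) σ) ∷ (q - 1# , compose τ σ) ∷ []
                                                    ≡⟨ ≡.cong (rename _) (TS-ascent q a τ (ℕ.≮⇒≥ ¬descent)) ⟨
            rename (λ τ' → compose τ' σ) (TS q a τ) ∎
            where open ≡.≡-Reasoning

      -- Both sides are double sums over τ ∈ 𝔖_m and the terms of w T_i, which agree termwise.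
      incl-TW-distinct : ∀ {i} → 1 ≤ i → i < n → at w i ≢ at w (suc i) → extend I (TW q i w) ≃ extend (TS q i) (I w)
      incl-TW-distinct {i} 1≤i i<n wᵢ≢wᵢ₊₁ = begin
        extend I (TW q i w)
          ≈⟨ extend-congˡ (TW q i w) (λ v → inclBasis≃ q m v) ⟩
        extend (λ v → extend (λ τ → basis (compose τ (std m v))) E) (TW q i w)
          ≈⟨ extend-comm (λ τ v → basis (compose τ (std m v))) E (TW q i w) ⟩
        extend (λ τ → extend (λ v → basis (compose τ (std m v))) (TW q i w)) E
          ≈⟨ extend-congˡ-on E (symmetrizer-Supp q m) (λ bp →
               ≃-trans (≃-sym (rename-extend _ (TW q i w))) (≡⇒≃ (≡.sym (TS-compose-distinct bp 1≤i i<n wᵢ≢wᵢ₊₁)))) ⟩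
        extend (λ τ → TS q i (compose τ σ)) E
          ≈⟨ extend-congˡ E (λ τ → extend-basis (TS q i) (compose τ σ)) ⟨
        extend (extend (TS q i) ∘ rightMul σ) E
          ≈⟨ extend-extend (rightMul σ) (TS q i) E ⟨
        extend (TS q i) (extend (rightMul σ) E)
          ≈⟨ extend-congʳ (TS q i) (inclBasis≃ q m w) ⟨
        extend (TS q i) (I w) ∎
        where open ≃-Reasoning

      incl-TW-equal : ∀ {i} → 1 ≤ i → i < n → at w i ≡ at w (suc i) → extend I (TW q i w) ≃ extend (TS q i) (I w)
      incl-TW-equal {i} 1≤i i<n wᵢ≡wᵢ₊₁ = begin
        extend I (TW q i w)                        ≡⟨ ≡.cong (extend I) (TW-descent q i w (ℕ.≤-reflexive (≡.sym wᵢ≡wᵢ₊₁))) ⟩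
        extend I ((q , swapAt i w) ∷ [])           ≡⟨ ≡.cong (λ v → extend I ((q , v) ∷ [])) (swapAt-fixed i w wᵢ≡wᵢ₊₁) ⟩
        extend I ((q , w) ∷ [])                    ≈⟨ extend-single I q w ⟩
        scale q (I w)                              ≈⟨ scale-cong refl (inclBasis≃ q m w) ⟩
        scale q (extend (rightMul σ) E)            ≈⟨ extend-scale (rightMul σ) q E ⟨
        extend (rightMul σ) (scale q E)            ≈⟨ extend-congʳ (rightMul σ) (symmetrizer-TS 1≤q sameBlock) ⟨
        extend (rightMul σ) (extend (TS q a) E)    ≈⟨ extend-intertwine (rightMul σ) (TS q a) (TS q i) E (symmetrizer-Supp q m) rightMul-TS ⟩
        extend (TS q i) (extend (rightMul σ) E)    ≈⟨ extend-congʳ (TS q i) (inclBasis≃ q m w) ⟨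
        extend (TS q i) (I w)                      ∎
        where
        open ≃-Reasoning
        open Consecutive 1≤i i<n wᵢ≡wᵢ₊₁
        rightMul-TS : ∀ {τ} → BlockPerm m τ → extend (rightMul σ) (TS q a τ) ≃ extend (TS q i) (rightMul σ τ)
        rightMul-TS {τ} bp = begin
          extend (rightMul σ) (TS q a τ)          ≈⟨ rename-extend _ (TS q a τ) ⟨
          rename (λ τ' → compose τ' σ) (TS q a τ) ≡⟨ TS-compose-consecutive bp ⟨
          TS q i (compose τ σ)                    ≈⟨ extend-basis (TS q i) (compose τ σ) ⟨
          extend (TS q i) (rightMul σ τ)          ∎

      incl-TW : ∀ {i} → 1 ≤ i → i < n → extend I (TW q i w) ≃ extend (TS q i) (I w)
      incl-TW {i} 1≤i i<n with at w i ℕ.≟ at w (suc i)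
      ... | no  wᵢ≢wᵢ₊₁ = incl-TW-distinct 1≤i i<n wᵢ≢wᵢ₊₁
      ... | yes wᵢ≡wᵢ₊₁ = incl-TW-equal 1≤i i<n wᵢ≡wᵢ₊₁

      incl-X : 0 < n → extend I (XW q m (xbar q m x) w) ≃ extend (XS q m x) (I w)
      incl-X 0<n = begin
        extend I (XW q m (xbar q m x) w)                 ≈⟨ extend-single I _ w ⟩
        scale (weightW q m (xbar q m x) (at w 1)) (I w)   ≈⟨ extend-diagonal (λ π → weightS q m x (at π 1)) (I w)
                                                              (map⁺ (All.map same-weight (Sm-BlockPerm m))) ⟨
        extend (XS q m x) (I w)                          ∎
        where
        open ≃-Reasoning
        same-weight : ∀ {τ} → BlockPerm m τ → weightS q m x (at (compose τ σ) 1) ≈ weightW q m (xbar q m x) (at w 1)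
        same-weight {τ} bp =
          trans (weight-compatible 1≤q m≢0 compat 1≤τσ₁ τσ₁≤n) (reflexive (≡.cong (weightW q m (xbar q m x)) (blk-compose bp ℕ.≤-refl 0<n)))
          where
          τσ₁≡ = at-compose τ ℕ.≤-refl 0<n
          s = slot-at ℕ.≤-refl 0<n
          bounds = BlockPerm.at-range bp (SlotFrom.1≤u s) (SlotFrom.u≤n s)
          1≤τσ₁ = ≡.subst (1 ≤_) (≡.sym τσ₁≡) (proj₁ bounds)
          τσ₁≤n = ≡.subst (_≤ n) (≡.sym τσ₁≡) (proj₂ bounds)

    incl-intertwines : ∀ w → w ↭ baseWord m →
                       incl q m (TWm q m (xbar q m x) (basis w)) ≋ TSn q m x (incl q m (basis w))
    incl-intertwines w w↭ = ≃⇒≋ (tsetlin-intertwine n (_↭ baseWord m) (TW q) (TS q) (XW q m (xbar q m x)) (XS q m x) I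
      (λ i {v} v↭ → TW-Supp q i v v↭ (↭-trans (swapAt-↭ i v) v↭)) (λ i 1≤i i<n v↭ → incl-TW v↭ 1≤i i<n) (λ 0<n v↭ → incl-X v↭ 0<n)
      (basis w) (w↭ ∷ []))

theorem3p15 : ∀ {c ℓ₁ ℓ₂} (F : OrderedField c ℓ₁ ℓ₂) →
  let open OrderedField F
      open Ops F
  in (q : Carrier) (m : List ℕ) (x : ℕ → Carrier) →
     1# ≤ q →
     All (λ k → k ≢ 0) m →
     (∀ i → 1 ℕ.≤ i → i ℕ.≤ sum m → 0# < x i) →
     sumF (map x (oneTo (sum m))) ≈ 1# →
     Compatible q m x →
     (∀ π → π ↭ oneTo (sum m) →
        proj m (TSn q m x (basis π)) ≋ TWm q m (xbar q m x) (proj m (basis π)))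
     ×
     (∀ w → w ↭ baseWord m →
        incl q m (TWm q m (xbar q m x) (basis w)) ≋ TSn q m x (incl q m (basis w)))
theorem3p15 F q m x 1≤q m≢0 _ _ compat =
  Projection.proj-intertwines F 1≤q m≢0 compat , Inclusion.incl-intertwines F 1≤q m≢0 compat
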